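{- For any $m,n\in\mathbb N$ with $m\ge 4$ even, there exists a cyclic $C_{m,(n)}$-decomposition of $K_v$ for every $v\equiv 1\pmod{2(m+n)}$.
   Context: For $m\ge 3$ and $n\ge 0$, $C_{m,(n)}$ is the connected graph with $m+n$ vertices and $m+n$ edges consisting of a cycle $C_m$ and a path $P_{n+1}$ (with $n+1$ vertices) having exactly one vertex in common, this vertex being an end vertex of the path (for $n=0$ it is just $C_m$). A cyclic $G$-decomposition of $K_v$ is a collection $\mathcal B$ of subgraphs of the complete graph $K_v$ on vertex set $\mathbb Z_v$, each isomorphic to $G$, whose edge sets partition the edge set of $K_v$, and such that $\mathcal B$ is mapped to itself by the permutation $i\mapsto i+1$ of $\mathbb Z_v$. -}

module Defs where

open import Data.Nat using (ℕ; zero; suc; _+_; _*_; _∸_; _<_; _%_)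
open import Data.Nat.DivMod using (m%n<n)
open import Data.Fin using (Fin; toℕ; fromℕ<)
open import Data.List using (List; []; _∷_; _++_; map; upTo)
open import Data.List.Relation.Unary.Any using (Any)
open import Data.Product using (_×_; _,_; ∃-syntax)
open import Data.Sum using (_⊎_)
open import Relation.Binary.PropositionalEquality using (_≡_; _≢_)
open import Function.Bundles using (_⇔_)

-- Vertices of the graph C_{m,(n)} are indexed by 0 .. m+n-1:
--   0 .. m-1      : the cycle c_0 c_1 ... c_{m-1} c_0
--   m .. m+n-1    : the path p_1 ... p_n, attached to the cycle vertex 0
--                   (so the path P_{n+1} is c_0 p_1 ... p_n).

cycleEdges : ℕ → List (ℕ × ℕ)
cycleEdges m = (m ∸ 1 , 0) ∷ map (λ i → (i , suc i)) (upTo (m ∸ 1))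

pathPrev : ℕ → ℕ → ℕ
pathPrev m zero    = 0
pathPrev m (suc j) = m + j

pathEdges : ℕ → ℕ → List (ℕ × ℕ)
pathEdges m n = map (λ j → (pathPrev m j , m + j)) (upTo n)

edgesC : ℕ → ℕ → List (ℕ × ℕ)
edgesC m n = cycleEdges m ++ pathEdges m n

-- A copy of C_{m,(n)} inside K_v (vertex set Z_v = Fin v):
-- an injective labelling of the m + n vertices of C_{m,(n)}.
record Copy (m n v : ℕ) : Set where
  field
    lab : ℕ → Fin v
    inj : ∀ i j → i < m + n → j < m + n → lab i ≡ lab j → i ≡ j
open Copy public

HasEdge : ∀ {m n v} → Copy m n v → Fin v → Fin v → Set
HasEdge {m} {n} B x y =
  Any (λ e → (lab B (Data.Product.proj₁ e) ≡ x × lab B (Data.Product.proj₂ e) ≡ y)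
           ⊎ (lab B (Data.Product.proj₁ e) ≡ y × lab B (Data.Product.proj₂ e) ≡ x))
      (edgesC m n)

shift : ∀ {k} → Fin (suc k) → Fin (suc k)
shift {k} x = fromℕ< (m%n<n (suc (toℕ x)) (suc k))

-- A cyclic C_{m,(n)}-decomposition of K_v (v = suc k): a finite family of
-- copies B_0 .. B_{b-1} such that
--  * every edge {x,y} (x ≠ y) of K_v lies in exactly one block
--    (so the edge sets partition E(K_v); in particular the blocks are distinct), and
--  * the translate (by i ↦ i+1) of every block is again a block of the family
--    (as a subgraph, i.e. has the same edge set).
record CyclicDecomposition (m n k : ℕ) : Set where
  field
    b      : ℕ
    block  : Fin b → Copy m n (suc k)
    unique : ∀ (x y : Fin (suc k)) → x ≢ y →
             ∃[ i ] (HasEdge (block i) x y ×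
                     (∀ j → HasEdge (block j) x y → j ≡ i))
    cyclic : ∀ (i : Fin b) → ∃[ j ] (∀ (x y : Fin (suc k)) →
               HasEdge (block i) x y ⇔ HasEdge (block j) (shift x) (shift y))

-- A ρ⁺-labelling of a bipartite graph G with e edges labels its vertices injectively by
-- 0, …, 2e so that every edge rises from the lower colour class to the upper one and the
-- edge lengths together with their complements to 2e + 1 are 1, …, 2e once each.  It
-- yields a cyclic G-decomposition of K_v for v = 2et + 1: for s < t lift the upper labels
-- by 2es; the differences ±(ℓ + 2es) of the lifted edges run exactly once through the
-- nonzero residues modulo v, so the translates of these t base blocks partition E(K_v).
--
-- For m even, C_{m,(n)} is bipartite with q = m + n edges.  Lay its vertices out as the
-- path p_n … p_1 c_0 c_1 … c_{m-1}; the remaining cycle edge is a chord from position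
-- q − 1 back to position n.  Label the even positions 0, 1, 2, … and the odd ones
-- 2q, 2q − 1, …, where the sequence containing position L + 1 skips D = q + 1 − L values
-- from there on; here L = n + m/2 + δ with δ ≡ m/2 (mod 2).  The path edges then have
-- lengths 2q, …, 2q − L + 1 and q − 1, …, L + 1, the chord has length q + δ, and with
-- their complements to 2q + 1 these are 1, …, 2q once each.

module Submission where

open import Defs
open import Data.Bool using (Bool; true; false; if_then_else_)
open import Data.Empty using (⊥-elim)
open import Data.Fin using (Fin; toℕ; fromℕ<; combine; remQuot)
open import Data.Fin.Properties using (toℕ-fromℕ<; toℕ-injective; toℕ<n; remQuot-combine; combine-remQuot)
open import Data.List.Relation.Unary.Any using (here; there)
import Data.List.Relation.Unary.Any as Any
open import Data.List.Membership.Propositional using (_∈_; find; lose)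
open import Data.List.Membership.Propositional.Properties
  using (∈-++⁻; ∈-++⁺ˡ; ∈-++⁺ʳ; ∈-map⁻; ∈-map⁺; ∈-upTo⁻; ∈-upTo⁺)
open import Data.Nat
open import Data.Nat.DivMod
open import Data.Nat.Divisibility using (_∣_; divides)
open import Data.Nat.Properties
open import Data.Nat.Tactic.RingSolver using (solve-∀)
open import Data.Product
open import Data.Sum using (_⊎_; inj₁; inj₂) renaming (map₂ to ⊎-map₂)
open import Function using (_∘_; id; const)
open import Function.Bundles using (_⇔_; mk⇔)
open import Relation.Nullary using (yes; no)
open import Relation.Binary.PropositionalEquality
open import Algebra.Properties.CommutativeSemigroup +-commutativeSemigroup using (xy∙z≈xz∙y)

[m%n+o]%n≡[m+o]%n : ∀ m o n .{{_ : NonZero n}} → (m % n + o) % n ≡ (m + o) % n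
[m%n+o]%n≡[m+o]%n m o n = begin
  (m % n + o) % n          ≡⟨ %-distribˡ-+ (m % n) o n ⟩
  (m % n % n + o % n) % n  ≡⟨ cong (λ x → (x + o % n) % n) (m%n%n≡m%n m n) ⟩
  (m % n + o % n) % n      ≡⟨ %-distribˡ-+ m o n ⟨
  (m + o) % n              ∎
  where open ≡-Reasoning

[m+o%n]%n≡[m+o]%n : ∀ m o n .{{_ : NonZero n}} → (m + o % n) % n ≡ (m + o) % n
[m+o%n]%n≡[m+o]%n m o n = begin
  (m + o % n) % n  ≡⟨ cong (_% n) (+-comm m (o % n)) ⟩
  (o % n + m) % n  ≡⟨ [m%n+o]%n≡[m+o]%n o m n ⟩
  (o + m) % n      ≡⟨ cong (_% n) (+-comm o m) ⟩
  (m + o) % n      ∎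
  where open ≡-Reasoning

[[m+k]%n+[n∸k]]%n≡m%n : ∀ m {k} n .{{_ : NonZero n}} → k ≤ n → ((m + k) % n + (n ∸ k)) % n ≡ m % n
[[m+k]%n+[n∸k]]%n≡m%n m {k} n k≤n = begin
  ((m + k) % n + (n ∸ k)) % n  ≡⟨ [m%n+o]%n≡[m+o]%n (m + k) (n ∸ k) n ⟩
  (m + k + (n ∸ k)) % n        ≡⟨ cong (_% n) (+-assoc m k (n ∸ k)) ⟩
  (m + (k + (n ∸ k))) % n      ≡⟨ cong (λ x → (m + x) % n) (m+[n∸m]≡n k≤n) ⟩
  (m + n) % n                  ≡⟨ [m+n]%n≡m%n m n ⟩
  m % n                        ∎
  where open ≡-Reasoning

[[m+[n∸k]]%n+k]%n≡m%n : ∀ m {k} n .{{_ : NonZero n}} → k ≤ n → ((m + (n ∸ k)) % n + k) % n ≡ m % n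
[[m+[n∸k]]%n+k]%n≡m%n m {k} n k≤n = begin
  ((m + (n ∸ k)) % n + k) % n        ≡⟨ cong (λ x → ((m + (n ∸ k)) % n + x) % n) (m∸[m∸n]≡n k≤n) ⟨
  ((m + (n ∸ k)) % n + (n ∸ (n ∸ k))) % n  ≡⟨ [[m+k]%n+[n∸k]]%n≡m%n m n (m∸n≤m n k) ⟩
  m % n                                    ∎
  where open ≡-Reasoning

+-cancelʳ-% : ∀ {a b} c n .{{_ : NonZero n}} → a < n → b < n → (a + c) % n ≡ (b + c) % n → a ≡ b
+-cancelʳ-% {a} {b} c n a<n b<n eq = begin
  a                                    ≡⟨ m<n⇒m%n≡m a<n ⟨
  a % n                                ≡⟨ unshift a ⟨
  ((a + c % n) % n + (n ∸ c % n)) % n  ≡⟨ cong (λ x → (x + (n ∸ c % n)) % n) reduced ⟩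
  ((b + c % n) % n + (n ∸ c % n)) % n  ≡⟨ unshift b ⟩
  b % n                                ≡⟨ m<n⇒m%n≡m b<n ⟩
  b                                    ∎
  where
  open ≡-Reasoning
  unshift : ∀ x → ((x + c % n) % n + (n ∸ c % n)) % n ≡ x % n
  unshift x = [[m+k]%n+[n∸k]]%n≡m%n x n (m%n≤n c n)
  reduced : (a + c % n) % n ≡ (b + c % n) % n
  reduced = trans ([m+o%n]%n≡[m+o]%n a c n) (trans eq (sym ([m+o%n]%n≡[m+o]%n b c n)))

+-cancelˡ-% : ∀ {a b} c n .{{_ : NonZero n}} → a < n → b < n → (c + a) % n ≡ (c + b) % n → a ≡ b
+-cancelˡ-% {a} {b} c n a<n b<n eq =
  +-cancelʳ-% c n a<n b<n (trans (cong (_% n) (+-comm a c)) (trans eq (cong (_% n) (+-comm c b))))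

divMod₁-unique : ∀ {N ρ ρ′ s s′} .{{_ : NonZero N}} → 1 ≤ ρ → ρ ≤ N → 1 ≤ ρ′ → ρ′ ≤ N →
                 ρ + s * N ≡ ρ′ + s′ * N → ρ ≡ ρ′ × s ≡ s′
divMod₁-unique {N} {suc r} {suc r′} {s} {s′} _ r<N _ r′<N eq =
  cong suc r≡r′ , *-cancelʳ-≡ s s′ N (+-cancelˡ-≡ r _ _ (trans eq′ (cong (_+ s′ * N) (sym r≡r′))))
  where
  eq′ : r + s * N ≡ r′ + s′ * N
  eq′ = suc-injective eq
  r≡r′ : r ≡ r′
  r≡r′ = begin
    r                ≡⟨ m<n⇒m%n≡m r<N ⟨
    r % N            ≡⟨ [m+kn]%n≡m%n r s N ⟨
    (r + s * N) % N  ≡⟨ cong (_% N) eq′ ⟩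
    (r′ + s′ * N) % N ≡⟨ [m+kn]%n≡m%n r′ s′ N ⟩
    r′ % N           ≡⟨ m<n⇒m%n≡m r′<N ⟩
    r′               ∎
    where open ≡-Reasoning

divMod₁ : ∀ {N t r} .{{_ : NonZero N}} → 1 ≤ r → r ≤ t * N →
          ∃₂ λ ρ s → (1 ≤ ρ × ρ ≤ N) × s < t × ρ + s * N ≡ r
divMod₁ {N} {t} {suc r} _ r<tN =
  suc (r % N) , r / N , (s≤s z≤n , m%n<n r N) , m<n*o⇒m/o<n r<tN , cong suc (sym (m≡m%n+[m/n]*n r N))

m∸[1+[m∸[1+n]]]≡n : ∀ {m n} → n < m → m ∸ suc (m ∸ suc n) ≡ n
m∸[1+[m∸[1+n]]]≡n {suc m} (s≤s n≤m) = m∸[m∸n]≡n n≤m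

data Edge (m n : ℕ) : ℕ × ℕ → Set where
  closing : Edge m n (m ∸ 1 , 0)
  cycle   : ∀ {i} → i < m ∸ 1 → Edge m n (i , suc i)
  path    : ∀ {j} → j < n → Edge m n (pathPrev m j , m + j)

∈edgesC⇒Edge : ∀ {m n e} → e ∈ edgesC m n → Edge m n e
∈edgesC⇒Edge {m} e∈ with ∈-++⁻ (cycleEdges m) e∈
... | inj₁ (here refl) = closing
... | inj₁ (there e∈cycle) with _ , i∈ , refl ← ∈-map⁻ (λ i → i , suc i) e∈cycle = cycle (∈-upTo⁻ i∈)
... | inj₂ e∈path with _ , j∈ , refl ← ∈-map⁻ (λ j → pathPrev m j , m + j) e∈path = path (∈-upTo⁻ j∈)

Edge⇒∈edgesC : ∀ {m n e} → Edge m n e → e ∈ edgesC m n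
Edge⇒∈edgesC closing = here refl
Edge⇒∈edgesC (cycle i<) = there (∈-++⁺ˡ (∈-map⁺ (λ i → i , suc i) (∈-upTo⁺ i<)))
Edge⇒∈edgesC {m} (path j<) = ∈-++⁺ʳ (cycleEdges m) (∈-map⁺ (λ j → pathPrev m j , m + j) (∈-upTo⁺ j<))

i<m∸1⇒1+i<m : ∀ {m i} .{{_ : NonZero m}} → i < m ∸ 1 → suc i < m
i<m∸1⇒1+i<m {m} i< = subst (_ <_) (m+[n∸m]≡n (>-nonZero⁻¹ m)) (s≤s i<)

Edge-bounded : ∀ {m n u w} .{{_ : NonZero m}} → Edge m n (u , w) → u < m + n × w < m + n
Edge-bounded {m} {n} closing =
  ≤-trans (∸-monoʳ-< {m} {1} {0} z<s (>-nonZero⁻¹ m)) (m≤m+n m n) , ≤-trans (>-nonZero⁻¹ m) (m≤m+n m n)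
Edge-bounded {m} {n} (cycle {i} i<) = <-trans (n<1+n i) 1+i<q , 1+i<q
  where
  1+i<q : suc i < m + n
  1+i<q = ≤-trans (i<m∸1⇒1+i<m i<) (m≤m+n m n)
Edge-bounded {m} {n} (path {zero} j<) = ≤-trans (>-nonZero⁻¹ m) (m≤m+n m n) , +-monoʳ-< m j<
Edge-bounded {m} {n} (path {suc j} j<) = +-monoʳ-< m (<-trans (n<1+n j) j<) , +-monoʳ-< m j<

-- ρ⁺-labellings and the decompositions they induce

data Crossing (upper : ℕ → Bool) (label : ℕ → ℕ) (u w : ℕ) : Set where
  ascending  : upper u ≡ false → upper w ≡ true → label u < label w → Crossing upper label u w
  descending : upper u ≡ true → upper w ≡ false → label w < label u → Crossing upper label u w

Crossing-sym : ∀ {upper label u w} → Crossing upper label u w → Crossing upper label w u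
Crossing-sym (ascending lu uw lt)  = descending uw lu lt
Crossing-sym (descending uu lw lt) = ascending lw uu lt

-- upper picks the colour class B; the last three fields are Rosa's ρ-condition: the
-- lengths and their complements to N + 1 run exactly once through 1, …, N = 2(m + n).
record RhoPlusLabelling (m n : ℕ) : Set where
  field
    label  : ℕ → ℕ
    upper  : ℕ → Bool
    label-injective : ∀ {u w} → u < m + n → w < m + n → label u ≡ label w → u ≡ w
    lower-label<    : ∀ {u} → u < m + n → upper u ≡ false → label u < 2 * (m + n)
    label≤          : ∀ {u} → u < m + n → label u ≤ 2 * (m + n)
    crossing        : ∀ {u w} → (u , w) ∈ edgesC m n → Crossing upper label u w
    length-injective : ∀ {u w u′ w′} → (u , w) ∈ edgesC m n → (u′ , w′) ∈ edgesC m n →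
                       ∣ label u - label w ∣ ≡ ∣ label u′ - label w′ ∣ → (u , w) ≡ (u′ , w′)
    length-sum≢     : ∀ {u w u′ w′} → (u , w) ∈ edgesC m n → (u′ , w′) ∈ edgesC m n →
                      ∣ label u - label w ∣ + ∣ label u′ - label w′ ∣ ≢ suc (2 * (m + n))
    length-cover    : ∀ {ρ} → 1 ≤ ρ → ρ ≤ 2 * (m + n) → ∃₂ λ u w → (u , w) ∈ edgesC m n ×
                      (∣ label u - label w ∣ ≡ ρ ⊎ ∣ label u - label w ∣ + ρ ≡ suc (2 * (m + n)))

Joins : ∀ {m n v} → Copy m n v → Fin v → Fin v → ℕ × ℕ → Set
Joins B x y e = (lab B (proj₁ e) ≡ x × lab B (proj₂ e) ≡ y) ⊎ (lab B (proj₁ e) ≡ y × lab B (proj₂ e) ≡ x)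

HasEdge-relabel : ∀ {m n v} {B B′ : Copy m n v} (f : Fin v → Fin v) → (∀ {x y} → f x ≡ f y → x ≡ y) →
                  (∀ u → lab B′ u ≡ f (lab B u)) → ∀ x y → HasEdge B x y ⇔ HasEdge B′ (f x) (f y)
HasEdge-relabel {B = B} {B′} f f-injective lab≡ x y = mk⇔ (Any.map forward) (Any.map backward)
  where
  forward : ∀ {e} → Joins B x y e → Joins B′ (f x) (f y) e
  forward {u , w} (inj₁ (ux , wy)) = inj₁ (trans (lab≡ u) (cong f ux) , trans (lab≡ w) (cong f wy))
  forward {u , w} (inj₂ (uy , wx)) = inj₂ (trans (lab≡ u) (cong f uy) , trans (lab≡ w) (cong f wx))
  backward : ∀ {e} → Joins B′ (f x) (f y) e → Joins B x y e
  backward {u , w} (inj₁ (ux , wy)) =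
    inj₁ (f-injective (trans (sym (lab≡ u)) ux) , f-injective (trans (sym (lab≡ w)) wy))
  backward {u , w} (inj₂ (uy , wx)) =
    inj₂ (f-injective (trans (sym (lab≡ u)) uy) , f-injective (trans (sym (lab≡ w)) wx))

module RhoPlusDecomposition {m n : ℕ} .{{_ : NonZero m}} (R : RhoPlusLabelling m n) (t : ℕ) where

  open RhoPlusLabelling R
  open ≡-Reasoning

  q N v : ℕ
  q = m + n
  N = 2 * q
  v = suc (t * N)

  instance
    N-nonZero : NonZero N
    N-nonZero = m*n≢0 2 q {{_}} {{>-nonZero (≤-trans (>-nonZero⁻¹ m) (m≤m+n m n))}}

  Link : ℕ → ℕ → Set
  Link a b = (a , b) ∈ edgesC m n ⊎ (b , a) ∈ edgesC m n

  link-crossing : ∀ {a b} → Link a b → Crossing upper label a b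
  link-crossing (inj₁ ab∈) = crossing ab∈
  link-crossing (inj₂ ba∈) = Crossing-sym (crossing ba∈)

  link-bounded : ∀ {a b} → Link a b → a < q × b < q
  link-bounded (inj₁ ab∈) = Edge-bounded (∈edgesC⇒Edge ab∈)
  link-bounded (inj₂ ba∈) = swap (Edge-bounded (∈edgesC⇒Edge ba∈))

  len : ℕ → ℕ → ℕ
  len a b = ∣ label a - label b ∣

  len-positive : ∀ {a b} → Link a b → 1 ≤ len a b
  len-positive {a} {b} ab with link-crossing ab
  ... | ascending _ _ lt  = subst (1 ≤_) (sym (m≤n⇒∣m-n∣≡n∸m (<⇒≤ lt))) (m<n⇒0<n∸m lt)
  ... | descending _ _ lt = subst (1 ≤_) (sym (m≤n⇒∣n-m∣≡n∸m (<⇒≤ lt))) (m<n⇒0<n∸m lt)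

  len≤N : ∀ {a b} → Link a b → len a b ≤ N
  len≤N {a} {b} ab = ≤-trans (∣m-n∣≤m⊔n (label a) (label b))
                              (⊔-lub (label≤ (proj₁ (link-bounded ab))) (label≤ (proj₂ (link-bounded ab))))

  len-sym : ∀ a b → len a b ≡ len b a
  len-sym a b = ∣-∣-comm (label a) (label b)

  link-len-injective : ∀ {a b a′ b′} → Link a b → Link a′ b′ → len a b ≡ len a′ b′ →
                       (a ≡ a′ × b ≡ b′) ⊎ (a ≡ b′ × b ≡ a′)
  link-len-injective (inj₁ p) (inj₁ p′) eq with refl ← length-injective p p′ eq = inj₁ (refl , refl)
  link-len-injective {a} {b} {a′} {b′} (inj₁ p) (inj₂ p′) eq
    with refl ← length-injective p p′ (trans eq (len-sym a′ b′)) = inj₂ (refl , refl)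
  link-len-injective {a} {b} {a′} {b′} (inj₂ p) (inj₁ p′) eq
    with refl ← length-injective p p′ (trans (len-sym b a) eq) = inj₂ (refl , refl)
  link-len-injective {a} {b} {a′} {b′} (inj₂ p) (inj₂ p′) eq
    with refl ← length-injective p p′ (trans (len-sym b a) (trans eq (len-sym a′ b′))) = inj₁ (refl , refl)

  link-edge : ∀ {a b} → Link a b → ∃₂ λ u w → (u , w) ∈ edgesC m n × len a b ≡ len u w
  link-edge (inj₁ ab∈) = _ , _ , ab∈ , refl
  link-edge {a} {b} (inj₂ ba∈) = b , a , ba∈ , len-sym a b

  link-len-sum≢ : ∀ {a b a′ b′} → Link a b → Link a′ b′ → len a b + len a′ b′ ≢ suc N
  link-len-sum≢ ab a′b′ =
    let (_ , _ , p , e) = link-edge ab ; (_ , _ , p′ , e′) = link-edge a′b′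
    in length-sum≢ p p′ ∘ trans (sym (cong₂ _+_ e e′))

  orient : ∀ {u w} → (u , w) ∈ edgesC m n → (side : Bool) →
           ∃₂ λ a b → Link a b × upper a ≡ side × len a b ≡ len u w
  orient {u} {w} p side with crossing p | side
  ... | ascending lu _ _  | false = u , w , inj₁ p , lu , refl
  ... | ascending _ uw _  | true  = w , u , inj₂ p , uw , len-sym w u
  ... | descending uu _ _ | true  = u , w , inj₁ p , uu , refl
  ... | descending _ lw _ | false = w , u , inj₂ p , lw , len-sym w u

  -- label b − label a reduced modulo N + 1
  orientedLength : ℕ → ℕ → ℕ
  orientedLength a b = if upper a then suc N ∸ len a b else len a b

  orientedLength-lower : ∀ {a b} → upper a ≡ false → orientedLength a b ≡ len a b
  orientedLength-lower ua rewrite ua = refl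

  orientedLength-upper : ∀ {a b} → upper a ≡ true → orientedLength a b ≡ suc N ∸ len a b
  orientedLength-upper ua rewrite ua = refl

  len≤1+N : ∀ {a b} → Link a b → len a b ≤ suc N
  len≤1+N ab = m≤n⇒m≤1+n (len≤N ab)

  orientedLength-bounds : ∀ {a b} → Link a b → 1 ≤ orientedLength a b × orientedLength a b ≤ N
  orientedLength-bounds {a} {b} ab with upper a
  ... | false = len-positive ab , len≤N ab
  ... | true  = m<n⇒0<n∸m (s≤s (len≤N ab)) , ∸-monoʳ-≤ (suc N) (len-positive ab)

  orientedLength-injective : ∀ {a b a′ b′} → Link a b → Link a′ b′ →
                             orientedLength a b ≡ orientedLength a′ b′ → a ≡ a′ × b ≡ b′
  orientedLength-injective {a} {b} {a′} {b′} ab a′b′ eq with link-crossing ab | link-crossing a′b′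
  ... | ascending la _ _ | ascending la′ ub′ _ = same (link-len-injective ab a′b′ len≡)
    where
    len≡ : len a b ≡ len a′ b′
    len≡ = trans (sym (orientedLength-lower la)) (trans eq (orientedLength-lower la′))
    same : (a ≡ a′ × b ≡ b′) ⊎ (a ≡ b′ × b ≡ a′) → a ≡ a′ × b ≡ b′
    same (inj₁ ≡≡) = ≡≡
    same (inj₂ (refl , _)) with () ← trans (sym la) ub′
  ... | descending ua _ _ | descending ua′ lb′ _ = same (link-len-injective ab a′b′ len≡)
    where
    len≡ : len a b ≡ len a′ b′
    len≡ = ∸-cancelˡ-≡ (len≤1+N ab) (len≤1+N a′b′)
             (trans (sym (orientedLength-upper ua)) (trans eq (orientedLength-upper ua′)))
    same : (a ≡ a′ × b ≡ b′) ⊎ (a ≡ b′ × b ≡ a′) → a ≡ a′ × b ≡ b′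
    same (inj₁ ≡≡) = ≡≡
    same (inj₂ (refl , _)) with () ← trans (sym ua) lb′
  ... | ascending la _ _ | descending ua′ _ _ = ⊥-elim (link-len-sum≢ ab a′b′ (begin
    len a b + len a′ b′                ≡⟨ cong (_+ len a′ b′) (orientedLength-lower la) ⟨
    orientedLength a b + len a′ b′     ≡⟨ cong (_+ len a′ b′) (trans eq (orientedLength-upper ua′)) ⟩
    (suc N ∸ len a′ b′) + len a′ b′    ≡⟨ m∸n+n≡m (len≤1+N a′b′) ⟩
    suc N                              ∎))
  ... | descending ua _ _ | ascending la′ _ _ = ⊥-elim (link-len-sum≢ ab a′b′ (begin
    len a b + len a′ b′                ≡⟨ cong (len a b +_) (orientedLength-lower la′) ⟨
    len a b + orientedLength a′ b′     ≡⟨ cong (len a b +_) (trans (sym eq) (orientedLength-upper ua)) ⟩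
    len a b + (suc N ∸ len a b)        ≡⟨ m+[n∸m]≡n (len≤1+N ab) ⟩
    suc N                              ∎))

  orientedLength-surjective : ∀ {ρ} → 1 ≤ ρ → ρ ≤ N → ∃₂ λ a b → Link a b × orientedLength a b ≡ ρ
  orientedLength-surjective {ρ} 1≤ρ ρ≤N with length-cover 1≤ρ ρ≤N
  ... | u , w , p , inj₁ len≡ρ =
    let (a , b , ab , la , len≡) = orient p false
    in a , b , ab , trans (orientedLength-lower la) (trans len≡ len≡ρ)
  ... | u , w , p , inj₂ len+ρ≡ =
    let (a , b , ab , ua , len≡) = orient p true
    in a , b , ab , (begin
      orientedLength a b            ≡⟨ orientedLength-upper ua ⟩
      suc N ∸ len a b               ≡⟨ cong (λ x → suc N ∸ x) len≡ ⟩
      suc N ∸ len u w               ≡⟨ cong (_∸ len u w) len+ρ≡ ⟨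
      len u w + ρ ∸ len u w         ≡⟨ m+n∸m≡n (len u w) ρ ⟩
      ρ                             ∎)

  -- v − (ℓ + sN) = (N + 1 − ℓ) + (t − 1 − s)N: read from its upper end, an edge of base
  -- block s lands in level t − 1 − s.
  level : ℕ → ℕ → ℕ
  level s a = if upper a then t ∸ suc s else s

  level<t : ∀ {s} a → s < t → level s a < t
  level<t a s<t with upper a
  ... | false = s<t
  ... | true  = ∸-monoʳ-< z<s s<t

  level-injective : ∀ {s s′} a → s < t → s′ < t → level s a ≡ level s′ a → s ≡ s′
  level-injective a s<t s′<t eq with upper a
  ... | false = eq
  ... | true  = suc-injective (∸-cancelˡ-≡ s<t s′<t eq)

  level-surjective : ∀ a {ℓ} → ℓ < t → ∃[ s ] (s < t × level s a ≡ ℓ)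
  level-surjective a {ℓ} ℓ<t with upper a
  ... | false = ℓ , ℓ<t , refl
  ... | true  = t ∸ suc ℓ , ∸-monoʳ-< z<s ℓ<t , m∸[1+[m∸[1+n]]]≡n ℓ<t

  -- stretch s b − stretch s a reduced modulo v (stretch-difference).  Writing residues in
  -- [1, tN] as ρ + ℓN with ρ ∈ [1, N] (divMod₁) splits the bijectivity of (s, a, b) ↦
  -- difference s a b into that of orientedLength and of level.
  difference : ℕ → ℕ → ℕ → ℕ
  difference s a b = orientedLength a b + level s a * N

  difference≤tN : ∀ {s a b} → Link a b → s < t → difference s a b ≤ t * N
  difference≤tN {s} {a} ab s<t =
    ≤-trans (+-monoˡ-≤ (level s a * N) (proj₂ (orientedLength-bounds ab))) (*-monoˡ-≤ N (level<t a s<t))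

  difference-injective : ∀ {S S′ : Fin t} {a b a′ b′} → Link a b → Link a′ b′ →
                         difference (toℕ S) a b ≡ difference (toℕ S′) a′ b′ → S ≡ S′ × a ≡ a′
  difference-injective {S} {S′} {a} {a′ = a′} ab a′b′ eq
    with ρ≡ , ℓ≡ ← divMod₁-unique {N} {s = level (toℕ S) a} {s′ = level (toℕ S′) a′}
                     (proj₁ (orientedLength-bounds ab)) (proj₂ (orientedLength-bounds ab))
                     (proj₁ (orientedLength-bounds a′b′)) (proj₂ (orientedLength-bounds a′b′)) eq
    with refl , _ ← orientedLength-injective ab a′b′ ρ≡
    = toℕ-injective (level-injective a (toℕ<n S) (toℕ<n S′) ℓ≡) , refl

  difference-surjective : ∀ {r} → 1 ≤ r → r ≤ t * N →
                          ∃[ S ] ∃₂ λ a b → Link a b × difference (toℕ S) a b ≡ r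
  difference-surjective 1≤r r≤tN
    with ρ , ℓ , (1≤ρ , ρ≤N) , ℓ<t , ρ+ℓN≡r ← divMod₁ {N} 1≤r r≤tN
    with a , b , ab , ρ≡ ← orientedLength-surjective 1≤ρ ρ≤N
    with s , s<t , ℓ≡ ← level-surjective a ℓ<t
    = fromℕ< s<t , a , b , ab ,
      trans (cong₂ (λ x y → x + level y a * N) ρ≡ (toℕ-fromℕ< s<t)) (trans (cong (λ y → ρ + y * N) ℓ≡) ρ+ℓN≡r)

  stretch : ℕ → ℕ → ℕ
  stretch s u = label u + (if upper u then s * N else 0)

  stretch<v : ∀ {s u} → s < t → u < q → stretch s u < v
  stretch<v {s} {u} s<t u<q with upper u in uu
  ... | false = s≤s (≤-trans (≤-reflexive (+-identityʳ (label u)))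
                      (≤-trans (<⇒≤ (lower-label< u<q uu)) (≤-trans (m≤m+n N (s * N)) (*-monoˡ-≤ N s<t))))
  ... | true  = s≤s (≤-trans (+-monoˡ-≤ (s * N) (label≤ u<q)) (*-monoˡ-≤ N s<t))

  lower-label≡lifted⇒≡ : ∀ {s u w} → u < q → w < q → upper u ≡ false → label u ≡ label w + s * N → u ≡ w
  lower-label≡lifted⇒≡ {zero}  {u} {w} u<q w<q _ eq = label-injective u<q w<q (trans eq (+-identityʳ (label w)))
  lower-label≡lifted⇒≡ {suc s} {u} {w} u<q w<q lu eq = ⊥-elim (<⇒≱ (lower-label< u<q lu)
    (≤-trans (m≤m+n N (s * N)) (≤-trans (m≤n+m _ (label w)) (≤-reflexive (sym eq)))))

  stretch-injective : ∀ {s u w} → u < q → w < q → stretch s u ≡ stretch s w → u ≡ w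
  stretch-injective {s} {u} {w} u<q w<q eq with upper u in uu | upper w in uw
  ... | false | false = label-injective u<q w<q (+-cancelʳ-≡ 0 _ _ eq)
  ... | true  | true  = label-injective u<q w<q (+-cancelʳ-≡ (s * N) _ _ eq)
  ... | false | true  = lower-label≡lifted⇒≡ {s} u<q w<q uu (trans (sym (+-identityʳ (label u))) eq)
  ... | true  | false = sym (lower-label≡lifted⇒≡ {s} w<q u<q uw (trans (sym (+-identityʳ (label w))) (sym eq)))

  stretch-difference : ∀ {s a b} → Link a b → s < t → (difference s a b + stretch s a) % v ≡ stretch s b % v
  stretch-difference {s} {a} {b} ab s<t with link-crossing ab
  ... | ascending la ub lt rewrite la | ub = cong (_% v) (begin
    len a b + s * N + (label a + 0)            ≡⟨ cong (λ x → x + s * N + (label a + 0)) (m≤n⇒∣m-n∣≡n∸m (<⇒≤ lt)) ⟩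
    label b ∸ label a + s * N + (label a + 0)  ≡⟨ rearrange (label b ∸ label a) (s * N) (label a) ⟩
    label b ∸ label a + label a + s * N        ≡⟨ cong (_+ s * N) (m∸n+n≡m (<⇒≤ lt)) ⟩
    label b + s * N                            ∎)
    where
    rearrange : ∀ x y z → x + y + (z + 0) ≡ x + z + y
    rearrange = solve-∀
  ... | descending ua lb lt rewrite ua | lb = begin
    (ℓ′ + r * N + (label a + s * N)) % v      ≡⟨ cong (λ x → (ℓ′ + r * N + (x + s * N)) % v) la≡ ⟩
    (ℓ′ + r * N + (ℓ + label b + s * N)) % v  ≡⟨ cong (_% v) (rearrange ℓ′ ℓ (label b) r s N) ⟩
    (ℓ′ + ℓ + (s + r) * N + label b) % v      ≡⟨ cong (λ x → (x + (s + r) * N + label b) % v) ℓ′+ℓ≡ ⟩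
    (suc (suc (s + r) * N) + label b) % v     ≡⟨ cong (λ x → (suc (x * N) + label b) % v) (m+[n∸m]≡n s<t) ⟩
    (v + label b) % v                         ≡⟨ cong (_% v) (+-comm v (label b)) ⟩
    (label b + v) % v                         ≡⟨ [m+n]%n≡m%n (label b) v ⟩
    label b % v                               ≡⟨ cong (_% v) (+-identityʳ (label b)) ⟨
    (label b + 0) % v                         ∎
    where
    ℓ : ℕ
    ℓ = len a b
    ℓ′ : ℕ
    ℓ′ = suc N ∸ ℓ
    r : ℕ
    r = t ∸ suc s
    ℓ′+ℓ≡ : ℓ′ + ℓ ≡ suc N
    ℓ′+ℓ≡ = m∸n+n≡m (len≤1+N ab)
    la≡ : label a ≡ ℓ + label b
    la≡ = trans (sym (m∸n+n≡m (<⇒≤ lt))) (cong (_+ label b) (sym (m≤n⇒∣n-m∣≡n∸m (<⇒≤ lt))))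
    rearrange : ∀ x ℓ y r s N → x + r * N + (ℓ + y + s * N) ≡ x + ℓ + (s + r) * N + y
    rearrange = solve-∀

  residue : ℕ → Fin v
  residue x = fromℕ< (m%n<n x v)

  toℕ-residue : ∀ x → toℕ (residue x) ≡ x % v
  toℕ-residue x = toℕ-fromℕ< (m%n<n x v)

  residue-injective : ∀ x y → residue x ≡ residue y → x % v ≡ y % v
  residue-injective x y eq = trans (sym (toℕ-residue x)) (trans (cong toℕ eq) (toℕ-residue y))

  copy : Fin t → Fin v → Copy m n v
  copy S C = record
    { lab = λ u → residue (stretch (toℕ S) u + toℕ C)
    ; inj = λ u w u<q w<q eq → stretch-injective {toℕ S} u<q w<q
              (+-cancelʳ-% (toℕ C) v (stretch<v (toℕ<n S) u<q) (stretch<v (toℕ<n S) w<q)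
                (residue-injective (stretch (toℕ S) u + toℕ C) (stretch (toℕ S) w + toℕ C) eq))
    }

  block : Fin (t * v) → Copy m n v
  block i = uncurry copy (remQuot v i)

  block-combine : ∀ S C → block (combine S C) ≡ copy S C
  block-combine S C = cong (uncurry copy) (remQuot-combine S C)

  copy-translates : ∀ S C {a b} → Link a b →
                    toℕ (lab (copy S C) b) ≡ (difference (toℕ S) a b + toℕ (lab (copy S C) a)) % v
  copy-translates S C {a} {b} ab = begin
    toℕ (residue (H b + c))       ≡⟨ toℕ-residue (H b + c) ⟩
    (H b + c) % v                 ≡⟨ [m%n+o]%n≡[m+o]%n (H b) c v ⟨
    (H b % v + c) % v             ≡⟨ cong (λ x → (x + c) % v) (stretch-difference ab (toℕ<n S)) ⟨
    ((d + H a) % v + c) % v       ≡⟨ [m%n+o]%n≡[m+o]%n (d + H a) c v ⟩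
    (d + H a + c) % v             ≡⟨ cong (_% v) (+-assoc d (H a) c) ⟩
    (d + (H a + c)) % v           ≡⟨ [m+o%n]%n≡[m+o]%n d (H a + c) v ⟨
    (d + (H a + c) % v) % v       ≡⟨ cong (λ x → (d + x) % v) (toℕ-residue (H a + c)) ⟨
    (d + toℕ (residue (H a + c))) % v ∎
    where
    c : ℕ
    c = toℕ C
    d : ℕ
    d = difference (toℕ S) a b
    H : ℕ → ℕ
    H = stretch (toℕ S)

  HasLink : Copy m n v → Fin v → Fin v → Set
  HasLink B x y = ∃₂ λ a b → Link a b × lab B a ≡ x × lab B b ≡ y

  HasLink⇒HasEdge : ∀ {B x y} → HasLink B x y → HasEdge B x y
  HasLink⇒HasEdge (_ , _ , inj₁ ab∈ , ax , by) = lose ab∈ (inj₁ (ax , by))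
  HasLink⇒HasEdge (_ , _ , inj₂ ba∈ , ax , by) = lose ba∈ (inj₂ (by , ax))

  HasEdge⇒HasLink : ∀ {B x y} → HasEdge B x y → HasLink B x y
  HasEdge⇒HasLink e with find e
  ... | (u , w) , uw∈ , inj₁ (ux , wy) = u , w , inj₁ uw∈ , ux , wy
  ... | (u , w) , uw∈ , inj₂ (uy , wx) = w , u , inj₂ uw∈ , wx , uy

  copy-anchor : ∀ S {u} → u < q → ∀ x → lab (copy S (residue (toℕ x + (v ∸ stretch (toℕ S) u)))) u ≡ x
  copy-anchor S {u} u<q x = toℕ-injective (begin
    toℕ (residue (H + toℕ (residue X)))  ≡⟨ toℕ-residue (H + toℕ (residue X)) ⟩
    (H + toℕ (residue X)) % v            ≡⟨ cong (λ z → (H + z) % v) (toℕ-residue X) ⟩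
    (H + X % v) % v                      ≡⟨ cong (_% v) (+-comm H (X % v)) ⟩
    (X % v + H) % v                      ≡⟨ [[m+[n∸k]]%n+k]%n≡m%n (toℕ x) v (<⇒≤ (stretch<v (toℕ<n S) u<q)) ⟩
    toℕ x % v                            ≡⟨ m<n⇒m%n≡m (toℕ<n x) ⟩
    toℕ x                                ∎)
    where
    H : ℕ
    H = stretch (toℕ S) u
    X : ℕ
    X = toℕ x + (v ∸ H)

  copy-injectiveʳ : ∀ S {C C′} u → lab (copy S C) u ≡ lab (copy S C′) u → C ≡ C′
  copy-injectiveʳ S {C} {C′} u eq = toℕ-injective (+-cancelˡ-% (stretch (toℕ S) u) v (toℕ<n C) (toℕ<n C′)
    (residue-injective (stretch (toℕ S) u + toℕ C) (stretch (toℕ S) u + toℕ C′) eq))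

  copy-difference : ∀ S C {a b x y} → Link a b → lab (copy S C) a ≡ x → lab (copy S C) b ≡ y →
                    (difference (toℕ S) a b + toℕ x) % v ≡ toℕ y
  copy-difference S C {a} {b} ab refl refl = sym (copy-translates S C ab)

  unique-block : ∀ x y → x ≢ y → ∃[ i ] (HasEdge (block i) x y × (∀ j → HasEdge (block j) x y → j ≡ i))
  unique-block x y x≢y = found (difference-surjective 1≤r (s≤s⁻¹ (m%n<n (toℕ y + (v ∸ toℕ x)) v)))
    where
    r : ℕ
    r = (toℕ y + (v ∸ toℕ x)) % v
    r+x≡y : (r + toℕ x) % v ≡ toℕ y
    r+x≡y = trans ([[m+[n∸k]]%n+k]%n≡m%n (toℕ y) v (<⇒≤ (toℕ<n x))) (m<n⇒m%n≡m (toℕ<n y))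
    1≤r : 1 ≤ r
    1≤r = n≢0⇒n>0 λ r≡0 → x≢y (toℕ-injective (begin
      toℕ x             ≡⟨ m<n⇒m%n≡m (toℕ<n x) ⟨
      (0 + toℕ x) % v   ≡⟨ cong (λ z → (z + toℕ x) % v) r≡0 ⟨
      (r + toℕ x) % v   ≡⟨ r+x≡y ⟩
      toℕ y             ∎))
    found : (∃[ S ] ∃₂ λ a b → Link a b × difference (toℕ S) a b ≡ r) →
            ∃[ i ] (HasEdge (block i) x y × (∀ j → HasEdge (block j) x y → j ≡ i))
    found (S , a , b , ab , d≡r) = combine S C , has , only
      where
      C : Fin v
      C = residue (toℕ x + (v ∸ stretch (toℕ S) a))
      a↦x : lab (copy S C) a ≡ x
      a↦x = copy-anchor S (proj₁ (link-bounded ab)) x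
      b↦y : lab (copy S C) b ≡ y
      b↦y = toℕ-injective (trans (copy-translates S C ab)
              (trans (cong (λ z → (difference (toℕ S) a b + toℕ z) % v) a↦x)
                (trans (cong (λ z → (z + toℕ x) % v) d≡r) r+x≡y)))
      has : HasEdge (block (combine S C)) x y
      has = subst (λ B → HasEdge B x y) (sym (block-combine S C))
              (HasLink⇒HasEdge {copy S C} (a , b , ab , a↦x , b↦y))
      difference≡ : ∀ {S′ C′ a′ b′} → Link a′ b′ → lab (copy S′ C′) a′ ≡ x → lab (copy S′ C′) b′ ≡ y →
                    difference (toℕ S′) a′ b′ ≡ difference (toℕ S) a b
      difference≡ {S′} {C′} a′b′ a′↦x b′↦y = trans
        (+-cancelʳ-% (toℕ x) v (s≤s (difference≤tN {toℕ S′} a′b′ (toℕ<n S′))) (m%n<n (toℕ y + (v ∸ toℕ x)) v)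
          (trans (copy-difference S′ C′ a′b′ a′↦x b′↦y) (sym r+x≡y)))
        (sym d≡r)
      only-copy : ∀ {j} (SC : Fin t × Fin v) → uncurry combine SC ≡ j → HasEdge (uncurry copy SC) x y →
                  j ≡ combine S C
      only-copy (S′ , C′) refl hj with HasEdge⇒HasLink {copy S′ C′} hj
      ... | a′ , b′ , a′b′ , a′↦x , b′↦y
            with difference-injective {S′} {S} a′b′ ab (difference≡ {S′} {C′} a′b′ a′↦x b′↦y)
      ... | refl , refl = cong (combine S) (copy-injectiveʳ S a (trans a′↦x (sym a↦x)))
      only : ∀ j → HasEdge (block j) x y → j ≡ combine S C
      only j = only-copy (remQuot {t} v j) (combine-remQuot {t} v j)

  shift-injective : ∀ {x y : Fin v} → shift x ≡ shift y → x ≡ y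
  shift-injective {x} {y} eq =
    toℕ-injective (+-cancelˡ-% 1 v (toℕ<n x) (toℕ<n y) (residue-injective (suc (toℕ x)) (suc (toℕ y)) eq))

  copy-shift : ∀ S C u → lab (copy S (shift C)) u ≡ shift (lab (copy S C) u)
  copy-shift S C u = toℕ-injective (begin
    toℕ (residue (H + toℕ (residue (suc (toℕ C)))))  ≡⟨ toℕ-residue (H + toℕ (residue (suc (toℕ C)))) ⟩
    (H + toℕ (residue (suc (toℕ C)))) % v            ≡⟨ cong (λ z → (H + z) % v) (toℕ-residue (suc (toℕ C))) ⟩
    (H + suc (toℕ C) % v) % v                        ≡⟨ [m+o%n]%n≡[m+o]%n H (suc (toℕ C)) v ⟩
    (H + suc (toℕ C)) % v                            ≡⟨ cong (_% v) (+-suc H (toℕ C)) ⟩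
    (1 + (H + toℕ C)) % v                            ≡⟨ [m+o%n]%n≡[m+o]%n 1 (H + toℕ C) v ⟨
    (1 + (H + toℕ C) % v) % v                        ≡⟨ cong (λ z → suc z % v) (toℕ-residue (H + toℕ C)) ⟨
    suc (toℕ (residue (H + toℕ C))) % v              ≡⟨ toℕ-residue (suc (toℕ (residue (H + toℕ C)))) ⟨
    toℕ (residue (suc (toℕ (residue (H + toℕ C)))))  ∎)
    where
    H : ℕ
    H = stretch (toℕ S) u

  cyclic-block : ∀ i → ∃[ j ] (∀ x y → HasEdge (block i) x y ⇔ HasEdge (block j) (shift x) (shift y))
  cyclic-block i = combine S (shift C) , λ x y →
    subst (λ B → HasEdge (block i) x y ⇔ HasEdge B (shift x) (shift y)) (sym (block-combine S (shift C)))
      (HasEdge-relabel {B = copy S C} {copy S (shift C)} shift shift-injective (copy-shift S C) x y)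
    where
    S : Fin t
    S = proj₁ (remQuot {t} v i)
    C : Fin v
    C = proj₂ (remQuot {t} v i)

  decomposition : CyclicDecomposition m n (t * N)
  decomposition = record { b = t * v ; block = block ; unique = unique-block ; cyclic = cyclic-block }

-- Prescribed edge lengths

chord-covers : ∀ {q δ ρ} → δ ≤ 1 → q ≤ ρ → ρ ≤ suc q → q + δ ≡ ρ ⊎ q + δ + ρ ≡ suc (q + q)
chord-covers {q} δ≤1 q≤ρ ρ≤q+1 with δ≤1 | m≤n⇒m<n∨m≡n q≤ρ
... | z≤n     | inj₂ refl = inj₁ (+-identityʳ q)
... | s≤s z≤n | inj₂ refl = inj₂ (cong (_+ q) (+-comm q 1))
... | z≤n     | inj₁ q<ρ with refl ← ≤-antisym q<ρ ρ≤q+1 = inj₂ (trans (cong (_+ suc q) (+-identityʳ q)) (+-suc q q))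
... | s≤s z≤n | inj₁ q<ρ with refl ← ≤-antisym q<ρ ρ≤q+1 = inj₁ (+-comm q 1)

-- The length X prescribed for edge c of the layout, which joins positions c and c + 1
-- (for c = q − 1 it is the chord): 2q − c for c < L, q + L − 1 − c from L on, and
-- q + δ for the chord.
data EdgeLength (q L δ : ℕ) : ℕ → ℕ → Set where
  long  : ∀ {c X} → c < L → X + c ≡ q + q → EdgeLength q L δ c X
  short : ∀ {c X} → L ≤ c → suc c < q → X + suc c ≡ q + L → EdgeLength q L δ c X
  chord : ∀ {c X} → suc c ≡ q → X ≡ q + δ → EdgeLength q L δ c X

module _ {q L δ : ℕ} (L<q : L < q) (δ≤1 : δ ≤ 1) where

  private
    long-range : ∀ {c X} → c < L → X + c ≡ q + q → suc (suc q) ≤ X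
    long-range {c} {X} c<L eq = +-cancelʳ-≤ c (suc (suc q)) X (begin
      suc (suc q) + c  ≡⟨ cong suc (+-suc q c) ⟨
      suc q + suc c    ≡⟨ +-suc q (suc c) ⟨
      q + suc (suc c)  ≤⟨ +-monoʳ-≤ q (≤-trans (s≤s c<L) L<q) ⟩
      q + q            ≡⟨ eq ⟨
      X + c            ∎)
      where open ≤-Reasoning

    short-range : ∀ {c X} → L ≤ c → X + suc c ≡ q + L → X < q
    short-range {c} {X} L≤c eq = +-cancelʳ-≤ c (suc X) q (begin
      suc X + c  ≡⟨ +-suc X c ⟨
      X + suc c  ≡⟨ eq ⟩
      q + L      ≤⟨ +-monoʳ-≤ q L≤c ⟩
      q + c      ∎)
      where open ≤-Reasoning

    chord-range : ∀ {X} → X ≡ q + δ → q ≤ X × X ≤ suc q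
    chord-range refl = m≤m+n q δ , ≤-trans (+-monoʳ-≤ q δ≤1) (≤-reflexive (+-comm q 1))

  EdgeLength-functional : ∀ {c X X′} → EdgeLength q L δ c X → EdgeLength q L δ c X′ → X ≡ X′
  EdgeLength-functional (long _ eq)       (long _ eq′)       = +-cancelʳ-≡ _ _ _ (trans eq (sym eq′))
  EdgeLength-functional (short _ _ eq)    (short _ _ eq′)    = +-cancelʳ-≡ _ _ _ (trans eq (sym eq′))
  EdgeLength-functional (chord _ eq)      (chord _ eq′)      = trans eq (sym eq′)
  EdgeLength-functional (long c<L _)      (short L≤c _ _)    = ⊥-elim (<⇒≱ c<L L≤c)
  EdgeLength-functional (short L≤c _ _)   (long c<L _)       = ⊥-elim (<⇒≱ c<L L≤c)
  EdgeLength-functional (long c<L _)      (chord refl _)     = ⊥-elim (<⇒≱ c<L (s≤s⁻¹ L<q))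
  EdgeLength-functional (chord refl _)    (long c<L _)       = ⊥-elim (<⇒≱ c<L (s≤s⁻¹ L<q))
  EdgeLength-functional (short _ c<q _)   (chord refl _)     = ⊥-elim (<-irrefl refl c<q)
  EdgeLength-functional (chord refl _)    (short _ c<q _)    = ⊥-elim (<-irrefl refl c<q)

  EdgeLength-injective : ∀ {c c′ X} → EdgeLength q L δ c X → EdgeLength q L δ c′ X → c ≡ c′
  EdgeLength-injective (long _ eq)      (long _ eq′)       = +-cancelˡ-≡ _ _ _ (trans eq (sym eq′))
  EdgeLength-injective (short _ _ eq)   (short _ _ eq′)    = suc-injective (+-cancelˡ-≡ _ _ _ (trans eq (sym eq′)))
  EdgeLength-injective (chord eq _)     (chord eq′ _)      = suc-injective (trans eq (sym eq′))
  EdgeLength-injective (long c<L eq)    (short L≤c′ _ eq′) =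
    ⊥-elim (<⇒≱ (long-range c<L eq) (≤-trans (<⇒≤ (short-range L≤c′ eq′)) (n≤1+n _)))
  EdgeLength-injective (short L≤c _ eq) (long c′<L eq′)    =
    ⊥-elim (<⇒≱ (long-range c′<L eq′) (≤-trans (<⇒≤ (short-range L≤c eq)) (n≤1+n _)))
  EdgeLength-injective (long c<L eq)    (chord _ eq′)      =
    ⊥-elim (<⇒≱ (long-range c<L eq) (proj₂ (chord-range eq′)))
  EdgeLength-injective (chord _ eq)     (long c′<L eq′)    =
    ⊥-elim (<⇒≱ (long-range c′<L eq′) (proj₂ (chord-range eq)))
  EdgeLength-injective (short L≤c _ eq) (chord _ eq′)      =
    ⊥-elim (<⇒≱ (short-range L≤c eq) (proj₁ (chord-range eq′)))
  EdgeLength-injective (chord _ eq)     (short L≤c′ _ eq′) =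
    ⊥-elim (<⇒≱ (short-range L≤c′ eq′) (proj₁ (chord-range eq)))

  private
    sum≢-below : ∀ {s} → s ≤ q + q → s ≢ suc (q + q)
    sum≢-below le eq = 1+n≰n (subst (_≤ q + q) eq le)

    sum≢-above : ∀ {s} → suc (suc (q + q)) ≤ s → s ≢ suc (q + q)
    sum≢-above le eq = 1+n≰n (subst (suc (suc (q + q)) ≤_) eq le)

    long+long : ∀ {X X′} → suc (suc q) ≤ X → suc (suc q) ≤ X′ → suc (suc (q + q)) ≤ X + X′
    long+long X≥ X′≥ = ≤-trans (s≤s (s≤s (+-monoʳ-≤ q (≤-trans (n≤1+n q) (n≤1+n (suc q)))))) (+-mono-≤ X≥ X′≥)

    short+chord : ∀ {X X′} → X < q → X′ ≤ suc q → X + X′ ≤ q + q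
    short+chord {X} {X′} X<q X′≤ = s≤s⁻¹ (begin
      suc X + X′  ≤⟨ +-mono-≤ X<q X′≤ ⟩
      q + suc q   ≡⟨ +-suc q q ⟩
      suc (q + q) ∎)
      where open ≤-Reasoning

    long+short : ∀ {c c′ X X′} → c < L → X + c ≡ q + q → suc c′ < q → X′ + suc c′ ≡ q + L →
                 X + X′ ≢ suc (q + q)
    long+short {c} {c′} {X} {X′} c<L eq suc-c′<q eq′ sum = 1+n≰n (begin
      suc (suc (c + suc c′))  ≡⟨ regroup c c′ ⟩
      suc c + suc (suc c′)    ≤⟨ +-mono-≤ c<L suc-c′<q ⟩
      L + q                   ≡⟨ +-comm L q ⟩
      q + L                   ≡⟨ cancel ⟩
      suc (c + suc c′)        ∎)
      where
      open ≤-Reasoning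
      regroup : ∀ c c′ → suc (suc (c + suc c′)) ≡ suc c + suc (suc c′)
      regroup = solve-∀
      rearrange : ∀ X X′ c c′ → X + c + (X′ + suc c′) ≡ (X + X′) + (c + suc c′)
      rearrange = solve-∀
      cancel : q + L ≡ suc (c + suc c′)
      cancel = +-cancelˡ-≡ (q + q) _ _ (begin-equality
        q + q + (q + L)               ≡⟨ cong₂ _+_ eq eq′ ⟨
        X + c + (X′ + suc c′)         ≡⟨ rearrange X X′ c c′ ⟩
        (X + X′) + (c + suc c′)       ≡⟨ cong (_+ (c + suc c′)) sum ⟩
        suc (q + q) + (c + suc c′)    ≡⟨ +-suc (q + q) (c + suc c′) ⟨
        q + q + suc (c + suc c′)      ∎)

  EdgeLength-sum≢ : ∀ {c c′ X X′} → EdgeLength q L δ c X → EdgeLength q L δ c′ X′ → X + X′ ≢ suc (q + q)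
  EdgeLength-sum≢ (long c<L eq) (long c′<L eq′) =
    sum≢-above (long+long (long-range c<L eq) (long-range c′<L eq′))
  EdgeLength-sum≢ (short L≤c _ eq) (short L≤c′ _ eq′) =
    sum≢-below (<⇒≤ (+-mono-< (short-range L≤c eq) (short-range L≤c′ eq′)))
  EdgeLength-sum≢ (chord _ refl) (chord _ refl) eq = even≢odd (q + δ) q (begin-equality
    2 * (q + δ)      ≡⟨ cong (q + δ +_) (+-identityʳ (q + δ)) ⟩
    q + δ + (q + δ)  ≡⟨ eq ⟩
    suc (q + q)      ≡⟨ cong (λ x → suc (q + x)) (+-identityʳ q) ⟨
    suc (2 * q)      ∎)
    where open ≤-Reasoning
  EdgeLength-sum≢ (long c<L eq) (chord _ eq′) =
    sum≢-above (+-mono-≤ (long-range c<L eq) (proj₁ (chord-range eq′)))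
  EdgeLength-sum≢ {X = X} {X′} (chord _ eq) (long c′<L eq′) =
    sum≢-above (subst (suc (suc (q + q)) ≤_) (+-comm X′ X) (+-mono-≤ (long-range c′<L eq′) (proj₁ (chord-range eq))))
  EdgeLength-sum≢ (short L≤c _ eq) (chord _ eq′) =
    sum≢-below (short+chord (short-range L≤c eq) (proj₂ (chord-range eq′)))
  EdgeLength-sum≢ {X = X} {X′} (chord _ eq) (short L≤c′ _ eq′) =
    sum≢-below (subst (_≤ q + q) (+-comm X′ X) (short+chord (short-range L≤c′ eq′) (proj₂ (chord-range eq))))
  EdgeLength-sum≢ (long c<L eq) (short _ c′<q eq′) = long+short c<L eq c′<q eq′
  EdgeLength-sum≢ {X = X} {X′} (short _ c<q eq) (long c′<L eq′) = long+short c′<L eq′ c<q eq ∘ trans (+-comm X′ X)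

  Covered : ℕ → Set
  Covered ρ = ∃₂ λ c X → c < q × EdgeLength q L δ c X × (X ≡ ρ ⊎ X + ρ ≡ suc (q + q))

  private
    covered-by-long-complement : ∀ {ρ} → 1 ≤ ρ → ρ ≤ L → Covered ρ
    covered-by-long-complement {suc c} _ c<L =
      c , X , <-trans c<L L<q , long c<L X+c≡ , inj₂ (trans (+-suc X c) (cong suc X+c≡))
      where
      X : ℕ
      X = q + q ∸ c
      X+c≡ : X + c ≡ q + q
      X+c≡ = m∸n+n≡m (≤-trans (<⇒≤ (<-trans c<L L<q)) (m≤m+n q q))

    covered-by-short : ∀ {ρ} → L < ρ → ρ < q → Covered ρ
    covered-by-short {ρ} L<ρ ρ<q with r , ρ+r≡ ← m≤n⇒∃[o]m+o≡n ρ<q =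
      r + L , ρ , <-trans (n<1+n _) c+1<q , short (m≤n+m L r) c+1<q ρ+c+1≡ , inj₁ refl
      where
      c+1<q : suc (r + L) < q
      c+1<q = begin-strict
        suc (r + L) ≡⟨ cong suc (+-comm r L) ⟩
        suc (L + r) <⟨ s≤s (+-monoˡ-≤ r L<ρ) ⟩
        suc (ρ + r) ≡⟨ ρ+r≡ ⟩
        q ∎
        where open ≤-Reasoning
      ρ+c+1≡ : ρ + suc (r + L) ≡ q + L
      ρ+c+1≡ = trans (rearrange ρ r L) (cong (_+ L) ρ+r≡)
        where
        rearrange : ∀ ρ r L → ρ + suc (r + L) ≡ suc ρ + r + L
        rearrange = solve-∀

    covered-by-chord : ∀ {ρ} → q ≤ ρ → ρ ≤ suc q → Covered ρ
    covered-by-chord q≤ρ ρ≤q+1 =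
      pred q , q + δ , pred<q , chord (suc-pred q) refl , chord-covers δ≤1 q≤ρ ρ≤q+1
      where
      instance
        q-nonZero : NonZero q
        q-nonZero = >-nonZero (≤-<-trans z≤n L<q)
      pred<q : pred q < q
      pred<q = ≤-reflexive (suc-pred q)

    covered-by-short-complement : ∀ {ρ} → suc q < ρ → ρ + L ≤ q + q → Covered ρ
    covered-by-short-complement {ρ} q+1<ρ ρ+L≤ with r , q+2+r≡ρ ← m≤n⇒∃[o]m+o≡n q+1<ρ =
      r + L , X , <-trans (n<1+n _) c+1<q , short (m≤n+m L r) c+1<q X+c+1≡ , inj₂ X+ρ≡
      where
      c+1<q : suc (r + L) < q
      c+1<q = +-cancelˡ-≤ q _ _ (begin
        q + suc (suc (r + L))    ≡⟨ rearrange q r L ⟩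
        suc (suc q) + r + L      ≡⟨ cong (_+ L) q+2+r≡ρ ⟩
        ρ + L                    ≤⟨ ρ+L≤ ⟩
        q + q                    ∎)
        where
        open ≤-Reasoning
        rearrange : ∀ q r L → q + suc (suc (r + L)) ≡ suc (suc q) + r + L
        rearrange = solve-∀
      r+1≤q : suc r ≤ q
      r+1≤q = ≤-trans (s≤s (m≤m+n r L)) (<⇒≤ c+1<q)
      X : ℕ
      X = q ∸ suc r
      X+r+1≡q : X + suc r ≡ q
      X+r+1≡q = m∸n+n≡m r+1≤q
      X+c+1≡ : X + suc (r + L) ≡ q + L
      X+c+1≡ = trans (sym (+-assoc X (suc r) L)) (cong (_+ L) X+r+1≡q)
      X+ρ≡ : X + ρ ≡ suc (q + q)
      X+ρ≡ = begin-equality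
        X + ρ                    ≡⟨ cong (X +_) q+2+r≡ρ ⟨
        X + (suc (suc q) + r)    ≡⟨ rearrange X q r ⟩
        X + suc r + suc q        ≡⟨ cong (_+ suc q) X+r+1≡q ⟩
        q + suc q                ≡⟨ +-suc q q ⟩
        suc (q + q)              ∎
        where
        open ≤-Reasoning
        rearrange : ∀ X q r → X + (suc (suc q) + r) ≡ X + suc r + suc q
        rearrange = solve-∀

    covered-by-long : ∀ {ρ} → q + q < ρ + L → ρ ≤ q + q → Covered ρ
    covered-by-long {ρ} 2q<ρ+L ρ≤2q with c , ρ+c≡ ← m≤n⇒∃[o]m+o≡n ρ≤2q =
      c , ρ , <-trans c<L L<q , long c<L ρ+c≡ , inj₁ refl
      where
      c<L : c < L
      c<L = +-cancelˡ-< ρ c L (subst (_< ρ + L) (sym ρ+c≡) 2q<ρ+L)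

  EdgeLength-cover : ∀ {ρ} → 1 ≤ ρ → ρ ≤ q + q → Covered ρ
  EdgeLength-cover {ρ} 1≤ρ ρ≤2q with ρ ≤? L
  ... | yes ρ≤L = covered-by-long-complement 1≤ρ ρ≤L
  ... | no ρ≰L with suc ρ ≤? q
  ...   | yes ρ<q = covered-by-short (≰⇒> ρ≰L) ρ<q
  ...   | no ρ≮q with ρ ≤? suc q
  ...     | yes ρ≤q+1 = covered-by-chord (s≤s⁻¹ (≰⇒> ρ≮q)) ρ≤q+1
  ...     | no ρ≰q+1 with ρ + L ≤? q + q
  ...       | yes ρ+L≤2q = covered-by-short-complement (≰⇒> ρ≰q+1) ρ+L≤2q
  ...       | no ρ+L≰2q = covered-by-long (≰⇒> ρ+L≰2q) ρ≤2q

-- Zigzag labellings of the layout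

interleave : {A : Set} → (ℕ → A) → (ℕ → A) → ℕ → A
interleave f g zero    = f 0
interleave f g (suc p) = interleave g (f ∘ suc) p

interleave-even : ∀ {A : Set} (f g : ℕ → A) i → interleave f g (i + i) ≡ f i
interleave-even f g zero    = refl
interleave-even f g (suc i) =
  trans (cong (interleave g (f ∘ suc)) (+-suc i i)) (interleave-even (f ∘ suc) (g ∘ suc) i)

interleave-odd : ∀ {A : Set} (f g : ℕ → A) i → interleave f g (suc (i + i)) ≡ g i
interleave-odd f g i = interleave-even g (f ∘ suc) i

interleave-even-suc : ∀ {A : Set} (f g : ℕ → A) i → interleave f g (suc (suc (i + i))) ≡ f (suc i)
interleave-even-suc f g i = interleave-even (f ∘ suc) (g ∘ suc) i

isOdd : ℕ → Bool
isOdd = interleave (const false) (const true)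

isOdd-even : ∀ i → isOdd (i + i) ≡ false
isOdd-even = interleave-even (const false) (const true)

isOdd-odd : ∀ i → isOdd (suc (i + i)) ≡ true
isOdd-odd = interleave-odd (const false) (const true)

isOdd-even-suc : ∀ i → isOdd (suc (suc (i + i))) ≡ false
isOdd-even-suc = interleave-even-suc (const false) (const true)

data Half : ℕ → Set where
  even : ∀ i → Half (i + i)
  odd  : ∀ i → Half (suc (i + i))

half : ∀ p → Half p
half zero = even 0
half (suc p) with half p
... | even i = odd i
... | odd i  = subst Half (cong suc (+-suc i i)) (even (suc i))

module Layout {m n : ℕ} .{{_ : NonZero m}} where

  q : ℕ
  q = m + n

  -- The layout p_n … p_1 c_0 … c_{m-1}: path vertex m + j sits at position n − 1 − j.
  position : ℕ → ℕ
  position u with u <? m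
  ... | yes _ = n + u
  ... | no _  = n ∸ suc (u ∸ m)

  position-cycle : ∀ {u} → u < m → position u ≡ n + u
  position-cycle {u} u<m with u <? m
  ... | yes _   = refl
  ... | no u≮m = ⊥-elim (u≮m u<m)

  position-path : ∀ j → position (m + j) ≡ n ∸ suc j
  position-path j with m + j <? m
  ... | yes m+j<m = ⊥-elim (<⇒≱ m+j<m (m≤m+n m j))
  ... | no _      = cong (λ k → n ∸ suc k) (m+n∸m≡n m j)

  position-pathPrev : ∀ {j} → j < n → position (pathPrev m j) ≡ suc (n ∸ suc j)
  position-pathPrev {zero}  j<n = trans (position-cycle (>-nonZero⁻¹ m)) (trans (+-identityʳ n) (+-∸-assoc 1 j<n))
  position-pathPrev {suc j} j<n = trans (position-path j) (+-∸-assoc 1 j<n)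

  data Vertex : ℕ → Set where
    on-cycle : ∀ {u} → u < m → Vertex u
    on-path  : ∀ {j} → j < n → Vertex (m + j)

  vertex : ∀ {u} → u < q → Vertex u
  vertex {u} u<q with u <? m
  ... | yes u<m = on-cycle u<m
  ... | no u≮m  = subst Vertex (m+[n∸m]≡n (≮⇒≥ u≮m))
                    (on-path (+-cancelˡ-< m (u ∸ m) n (subst (_< q) (sym (m+[n∸m]≡n (≮⇒≥ u≮m))) u<q)))

  n∸suc<n : ∀ {j} → j < n → n ∸ suc j < n
  n∸suc<n j<n = ∸-monoʳ-< z<s j<n

  position<q : ∀ {u} → u < q → position u < q
  position<q u<q with vertex u<q
  ... | on-cycle {u} u<m = subst (_< q) (sym (position-cycle u<m)) (subst (n + u <_) (+-comm n m) (+-monoʳ-< n u<m))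
  ... | on-path {j} j<n  = subst (_< q) (sym (position-path j)) (≤-trans (n∸suc<n j<n) (m≤n+m n m))

  position-injective : ∀ {u w} → u < q → w < q → position u ≡ position w → u ≡ w
  position-injective u<q w<q eq with vertex u<q | vertex w<q
  ... | on-cycle {u} u<m | on-cycle {w} w<m =
    +-cancelˡ-≡ n u w (trans (sym (position-cycle u<m)) (trans eq (position-cycle w<m)))
  ... | on-path {j} j<n | on-path {j′} j′<n =
    cong (m +_) (suc-injective (∸-cancelˡ-≡ j<n j′<n (trans (sym (position-path j)) (trans eq (position-path j′)))))
  ... | on-cycle {u} u<m | on-path {j′} j′<n = ⊥-elim (<⇒≱ (n∸suc<n j′<n)
    (≤-trans (m≤m+n n u) (≤-reflexive (trans (sym (position-cycle u<m)) (trans eq (position-path j′))))))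
  ... | on-path {j} j<n | on-cycle {w} w<m = ⊥-elim (<⇒≱ (n∸suc<n j<n)
    (≤-trans (m≤m+n n w) (≤-reflexive (trans (sym (position-cycle w<m)) (trans (sym eq) (position-path j))))))

  -- Cycle and path edges join positions code k and code k + 1; the closing edge is the
  -- chord from position n + (m − 1) = q − 1 to n.
  code : ∀ {e} → Edge m n e → ℕ
  code closing         = n + (m ∸ 1)
  code (cycle {i} _)   = n + i
  code (path {j} _)    = n ∸ suc j

  code-injective : ∀ {e e′} (k : Edge m n e) (k′ : Edge m n e′) → code k ≡ code k′ → e ≡ e′
  code-injective closing closing _ = refl
  code-injective (cycle {i} _) (cycle {i′} _) eq = cong (λ k → k , suc k) (+-cancelˡ-≡ n i i′ eq)
  code-injective (path {j} j<n) (path {j′} j′<n) eq =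
    cong (λ k → pathPrev m k , m + k) (suc-injective (∸-cancelˡ-≡ j<n j′<n eq))
  code-injective closing (cycle i<) eq = ⊥-elim (<-irrefl (sym (+-cancelˡ-≡ n _ _ eq)) i<)
  code-injective (cycle i<) closing eq = ⊥-elim (<-irrefl (+-cancelˡ-≡ n _ _ eq) i<)
  code-injective closing (path j<n) eq = ⊥-elim (<⇒≱ (n∸suc<n j<n) (≤-trans (m≤m+n n _) (≤-reflexive eq)))
  code-injective (path j<n) closing eq = ⊥-elim (<⇒≱ (n∸suc<n j<n) (≤-trans (m≤m+n n _) (≤-reflexive (sym eq))))
  code-injective (cycle _) (path j<n) eq = ⊥-elim (<⇒≱ (n∸suc<n j<n) (≤-trans (m≤m+n n _) (≤-reflexive eq)))
  code-injective (path j<n) (cycle _) eq = ⊥-elim (<⇒≱ (n∸suc<n j<n) (≤-trans (m≤m+n n _) (≤-reflexive (sym eq))))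

  code-surjective : ∀ {c} → c < q → ∃₂ λ u w → Σ (Edge m n (u , w)) λ k → code k ≡ c
  code-surjective {c} c<q with c <? n
  ... | yes c<n = _ , _ , path (n∸suc<n c<n) , m∸[1+[m∸[1+n]]]≡n c<n
  ... | no c≮n with c ∸ n <? m ∸ 1
  ...   | yes i< = _ , _ , cycle i< , m+[n∸m]≡n (≮⇒≥ c≮n)
  ...   | no i≮ = _ , _ , closing , trans (cong (n +_) (≤-antisym (≮⇒≥ i≮) i≤)) (m+[n∸m]≡n (≮⇒≥ c≮n))
    where
    i≤ : c ∸ n ≤ m ∸ 1
    i≤ = subst (c ∸ n ≤_) (pred[m∸n]≡m∸[1+n] m 0) (<⇒≤pred (m<n+o⇒m∸n<o c n (subst (c <_) (+-comm m n) c<q)))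

-- lower i and upper i label the layout positions 2i and 2i + 1.
record Zigzag (m n : ℕ) : Set where
  field
    L δ             : ℕ
    L<q             : L < m + n
    δ≤1             : δ ≤ 1
    lower upper     : ℕ → ℕ
    lower-injective : ∀ {i j} → i + i < m + n → j + j < m + n → lower i ≡ lower j → i ≡ j
    upper-injective : ∀ {i j} → suc (i + i) < m + n → suc (j + j) < m + n → upper i ≡ upper j → i ≡ j
    lower<upper     : ∀ {i j} → i + i < m + n → suc (j + j) < m + n → lower i < upper j
    lower<q+q       : ∀ {i} → i + i < m + n → lower i < (m + n) + (m + n)
    upper≤q+q       : ∀ {j} → suc (j + j) < m + n → upper j ≤ (m + n) + (m + n)
    rising          : ∀ {i} → suc (i + i) < m + n → EdgeLength (m + n) L δ (i + i) (upper i ∸ lower i)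
    falling         : ∀ {i} → suc (suc (i + i)) < m + n →
                      EdgeLength (m + n) L δ (suc (i + i)) (upper i ∸ lower (suc i))
    closing-crossing : Crossing isOdd (interleave lower upper) (n + (m ∸ 1)) n
    closing-length   : EdgeLength (m + n) L δ (n + (m ∸ 1))
                         ∣ interleave lower upper (n + (m ∸ 1)) - interleave lower upper n ∣

module FromZigzag {m n : ℕ} .{{_ : NonZero m}} (Z : Zigzag m n) where

  open Zigzag Z
  open Layout {m} {n}

  label : ℕ → ℕ
  label = interleave lower upper

  label-even : ∀ i → label (i + i) ≡ lower i
  label-even = interleave-even lower upper

  label-odd : ∀ i → label (suc (i + i)) ≡ upper i
  label-odd = interleave-odd lower upper

  label-even-suc : ∀ i → label (suc (suc (i + i))) ≡ lower (suc i)
  label-even-suc = interleave-even-suc lower upper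

  2q≡q+q : 2 * q ≡ q + q
  2q≡q+q = cong (q +_) (+-identityʳ q)

  label-injective : ∀ {p p′} → p < q → p′ < q → label p ≡ label p′ → p ≡ p′
  label-injective {p} {p′} p<q p′<q eq with half p | half p′
  ... | even i | even j =
    cong (λ k → k + k) (lower-injective p<q p′<q (trans (sym (label-even i)) (trans eq (label-even j))))
  ... | odd i  | odd j  =
    cong (λ k → suc (k + k)) (upper-injective p<q p′<q (trans (sym (label-odd i)) (trans eq (label-odd j))))
  ... | even i | odd j  =
    ⊥-elim (<-irrefl (trans (sym (label-even i)) (trans eq (label-odd j))) (lower<upper p<q p′<q))
  ... | odd i  | even j =
    ⊥-elim (<-irrefl (trans (sym (label-even j)) (trans (sym eq) (label-odd i))) (lower<upper p′<q p<q))

  lower-label< : ∀ {p} → p < q → isOdd p ≡ false → label p < 2 * q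
  lower-label< {p} p<q lower-side with half p
  ... | even i = subst₂ _<_ (sym (label-even i)) (sym 2q≡q+q) (lower<q+q p<q)
  ... | odd i with () ← trans (sym (isOdd-odd i)) lower-side

  label≤2q : ∀ {p} → p < q → label p ≤ 2 * q
  label≤2q {p} p<q with half p
  ... | even i = subst₂ _≤_ (sym (label-even i)) (sym 2q≡q+q) (<⇒≤ (lower<q+q p<q))
  ... | odd i  = subst₂ _≤_ (sym (label-odd i)) (sym 2q≡q+q) (upper≤q+q p<q)

  step : ∀ {p} → suc p < q → Crossing isOdd label p (suc p) × EdgeLength q L δ p ∣ label p - label (suc p) ∣
  step {p} p+1<q with half p
  ... | even i = ascending (isOdd-even i) (isOdd-odd i) (subst₂ _<_ (sym (label-even i)) (sym (label-odd i)) lt) ,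
                 subst (EdgeLength q L δ (i + i)) (sym length≡) (rising p+1<q)
    where
    lt : lower i < upper i
    lt = lower<upper (<-trans (n<1+n _) p+1<q) p+1<q
    length≡ : ∣ label (i + i) - label (suc (i + i)) ∣ ≡ upper i ∸ lower i
    length≡ = trans (cong₂ ∣_-_∣ (label-even i) (label-odd i)) (m≤n⇒∣m-n∣≡n∸m (<⇒≤ lt))
  ... | odd i  = descending (isOdd-odd i) (isOdd-even-suc i)
                   (subst₂ _<_ (sym (label-even-suc i)) (sym (label-odd i)) lt) ,
                 subst (EdgeLength q L δ (suc (i + i))) (sym length≡) (falling p+1<q)
    where
    lt : lower (suc i) < upper i
    lt = lower<upper (subst (_< q) (cong suc (sym (+-suc i i))) p+1<q) (<-trans (n<1+n _) p+1<q)
    length≡ : ∣ label (suc (i + i)) - label (suc (suc (i + i))) ∣ ≡ upper i ∸ lower (suc i)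
    length≡ = trans (cong₂ ∣_-_∣ (label-odd i) (label-even-suc i)) (m≤n⇒∣n-m∣≡n∸m (<⇒≤ lt))

  EdgeInfo : ℕ → ℕ → ℕ → Set
  EdgeInfo c u w = Crossing (isOdd ∘ position) (label ∘ position) u w ×
                   EdgeLength q L δ c ∣ label (position u) - label (position w) ∣

  private
    at-positions : ∀ {c u w p p′} → position u ≡ p → position w ≡ p′ →
                   Crossing isOdd label p p′ × EdgeLength q L δ c ∣ label p - label p′ ∣ → EdgeInfo c u w
    at-positions refl refl (ascending lu uw lt , el)  = ascending lu uw lt , el
    at-positions refl refl (descending uu lw lt , el) = descending uu lw lt , el

    at-positions-reversed : ∀ {c u w p p′} → position u ≡ p′ → position w ≡ p →
                            Crossing isOdd label p p′ × EdgeLength q L δ c ∣ label p - label p′ ∣ → EdgeInfo c u w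
    at-positions-reversed {c} {p = p} {p′} u↦p′ w↦p (cr , el) =
      at-positions u↦p′ w↦p (Crossing-sym cr , subst (EdgeLength q L δ c) (∣-∣-comm (label p) (label p′)) el)

  edge-info : ∀ {u w} (k : Edge m n (u , w)) → EdgeInfo (code k) u w
  edge-info closing =
    at-positions (position-cycle (∸-monoʳ-< z<s (>-nonZero⁻¹ m)))
                 (trans (position-cycle (>-nonZero⁻¹ m)) (+-identityʳ n))
      (closing-crossing , closing-length)
  edge-info (cycle {i} i<) =
    at-positions (position-cycle (<-trans (n<1+n i) (i<m∸1⇒1+i<m i<)))
                 (trans (position-cycle (i<m∸1⇒1+i<m i<)) (+-suc n i))
      (step (subst (_< q) (+-suc n i) (subst (n + suc i <_) (+-comm n m) (+-monoʳ-< n (i<m∸1⇒1+i<m i<)))))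
  edge-info (path {j} j<n) =
    at-positions-reversed (position-pathPrev j<n) (position-path j)
      (step (subst (_< q) (+-∸-assoc 1 j<n) (≤-<-trans (m∸n≤m n j) (m<n+m n (>-nonZero⁻¹ m)))))

  rhoPlus : RhoPlusLabelling m n
  rhoPlus = record
    { label            = label ∘ position
    ; upper            = isOdd ∘ position
    ; label-injective  = λ u<q w<q → position-injective u<q w<q ∘ label-injective (position<q u<q) (position<q w<q)
    ; lower-label<     = λ u<q → lower-label< (position<q u<q)
    ; label≤           = λ u<q → label≤2q (position<q u<q)
    ; crossing         = λ p → proj₁ (edge-info (∈edgesC⇒Edge p))
    ; length-injective = λ p p′ eq → code-injective (∈edgesC⇒Edge p) (∈edgesC⇒Edge p′)
                           (EdgeLength-injective L<q δ≤1 (proj₂ (edge-info (∈edgesC⇒Edge p)))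
                             (subst (EdgeLength q L δ _) (sym eq) (proj₂ (edge-info (∈edgesC⇒Edge p′)))))
    ; length-sum≢      = λ p p′ eq → EdgeLength-sum≢ L<q δ≤1 (proj₂ (edge-info (∈edgesC⇒Edge p)))
                           (proj₂ (edge-info (∈edgesC⇒Edge p′))) (trans eq (cong suc 2q≡q+q))
    ; length-cover     = cover
    }
    where
    ℓ : ℕ → ℕ → ℕ
    ℓ u w = ∣ label (position u) - label (position w) ∣
    cover : ∀ {ρ} → 1 ≤ ρ → ρ ≤ 2 * q → ∃₂ λ u w → (u , w) ∈ edgesC m n × (ℓ u w ≡ ρ ⊎ ℓ u w + ρ ≡ suc (2 * q))
    cover {ρ} 1≤ρ ρ≤2q with EdgeLength-cover L<q δ≤1 1≤ρ (subst (ρ ≤_) 2q≡q+q ρ≤2q)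
    ... | c , X , c<q , el , covers with code-surjective c<q
    ...   | u , w , k , refl with EdgeLength-functional L<q δ≤1 (proj₂ (edge-info k)) el
    ...     | refl = u , w , Edge⇒∈edgesC k , ⊎-map₂ (λ eq → trans eq (cong suc (sym 2q≡q+q))) covers

-- The labellings for m even

skip : ℕ → ℕ → ℕ → ℕ
skip t D i with t ≤? i
... | yes _ = i + D
... | no _  = i

skip-below : ∀ {t D i} → i < t → skip t D i ≡ i
skip-below {t} {D} {i} i<t with t ≤? i
... | yes t≤i = ⊥-elim (<⇒≱ i<t t≤i)
... | no _    = refl

skip-above : ∀ {t D i} → t ≤ i → skip t D i ≡ i + D
skip-above {t} {D} {i} t≤i with t ≤? i
... | yes _   = refl
... | no t≰i = ⊥-elim (t≰i t≤i)

skip≤ : ∀ t D i → skip t D i ≤ i + D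
skip≤ t D i with t ≤? i
... | yes _ = ≤-refl
... | no _  = m≤m+n i D

skip-injective : ∀ t D {i j} → skip t D i ≡ skip t D j → i ≡ j
skip-injective t D {i} {j} eq with t ≤? i | t ≤? j
... | yes _   | yes _   = +-cancelʳ-≡ D i j eq
... | no _    | no _    = eq
... | no t≰i  | yes t≤j = ⊥-elim (t≰i (≤-trans t≤j (≤-trans (m≤m+n j D) (≤-reflexive (sym eq)))))
... | yes t≤i | no t≰j  = ⊥-elim (t≰j (≤-trans t≤i (≤-trans (m≤m+n i D) (≤-reflexive eq))))

+-half-< : ∀ {x y} → x + x < y + y → x < y
+-half-< {x} {y} lt with x <? y
... | yes x<y = x<y
... | no x≮y  = ⊥-elim (<⇒≱ lt (+-mono-≤ (≮⇒≥ x≮y) (≮⇒≥ x≮y)))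

even+odd<q : ∀ {q i j} → i + i < q → suc (j + j) < q → suc (suc (i + j)) ≤ q
even+odd<q {q} {i} {j} i+i<q j+j+1<q = +-half-< (begin-strict
  suc (i + j) + suc (i + j)    ≡⟨ rearrange i j ⟩
  suc (i + i) + suc (j + j)    <⟨ +-mono-≤-< i+i<q j+j+1<q ⟩
  q + q                        ∎)
  where
  open ≤-Reasoning
  rearrange : ∀ i j → suc (i + j) + suc (i + j) ≡ suc (i + i) + suc (j + j)
  rearrange = solve-∀

-- q + L + D = 2q + 1: a gap of D labels between positions L and L + 1 lowers the length
-- of every edge c ≥ L from 2q − c to q + L − 1 − c.
module Gap (q L D : ℕ) (fits : q + L + D ≡ suc (q + q)) (1≤L : 1 ≤ L) where

  2≤D⇒L<q : 2 ≤ D → L < q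
  2≤D⇒L<q 2≤D = +-cancelˡ-≤ q _ _ (s≤s⁻¹ (begin
    suc (q + suc L)   ≡⟨ rearrange q L ⟩
    q + L + 2         ≤⟨ +-monoʳ-≤ (q + L) 2≤D ⟩
    q + L + D         ≡⟨ fits ⟩
    suc (q + q)       ∎))
    where
    open ≤-Reasoning
    rearrange : ∀ q L → suc (q + suc L) ≡ q + L + 2
    rearrange = solve-∀

  D≤q : D ≤ q
  D≤q = +-cancelˡ-≤ q _ _ (s≤s⁻¹ (begin
    suc (q + D)       ≡⟨ rearrange q D ⟩
    q + 1 + D         ≤⟨ +-monoˡ-≤ D (+-monoʳ-≤ q 1≤L) ⟩
    q + L + D         ≡⟨ fits ⟩
    suc (q + q)       ∎))
    where
    open ≤-Reasoning
    rearrange : ∀ q D → suc (q + D) ≡ q + 1 + D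
    rearrange = solve-∀

  q+q∸a∸b+[a+b]≡q+q : ∀ a b → a + b ≤ q + q → q + q ∸ a ∸ b + (a + b) ≡ q + q
  q+q∸a∸b+[a+b]≡q+q a b a+b≤ = trans (cong (_+ (a + b)) (∸-+-assoc (q + q) a b)) (m∸n+n≡m a+b≤)

  short-length : ∀ {X c} → X + (c + D) ≡ q + q → X + suc c ≡ q + L
  short-length {X} {c} eq = +-cancelʳ-≡ D _ _ (begin
    X + suc c + D       ≡⟨ rearrange X c D ⟩
    suc (X + (c + D))   ≡⟨ cong suc eq ⟩
    suc (q + q)         ≡⟨ fits ⟨
    q + L + D           ∎)
    where
    open ≡-Reasoning
    rearrange : ∀ X c D → X + suc c + D ≡ suc (X + (c + D))
    rearrange = solve-∀

  c+D≤q+q : ∀ {c} → c < q → c + D ≤ q + q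
  c+D≤q+q c<q = +-mono-≤ (<⇒≤ c<q) D≤q

  1+i+j+D≤q+q : ∀ i j → i + i < q → suc (j + j) < q → suc (i + j) + D ≤ q + q
  1+i+j+D≤q+q i j i+i<q 2j+1<q = +-mono-≤ (≤-trans (n≤1+n _) (even+odd<q {q} {i} {j} i+i<q 2j+1<q)) D≤q

i+i<q⇒i<q : ∀ i {q} → i + i < q → i < q
i+i<q⇒i<q i = ≤-<-trans (m≤m+n i i)

-- Edge L joins positions L and L + 1, so for L even the gap goes into the upper labels,
-- for L odd (LowerGap) into the lower ones.
module UpperGap (q w D : ℕ) (fits : q + (w + w) + D ≡ suc (q + q)) (1≤w : 1 ≤ w) where

  open Gap q (w + w) D fits (≤-trans 1≤w (m≤m+n w w)) public

  lower upper : ℕ → ℕ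
  lower i = i
  upper i = q + q ∸ skip w D i

  skip≤q+q : ∀ {i} → i < q → skip w D i ≤ q + q
  skip≤q+q {i} i<q = ≤-trans (skip≤ w D i) (c+D≤q+q i<q)

  upper-injective : ∀ {i j} → suc (i + i) < q → suc (j + j) < q → upper i ≡ upper j → i ≡ j
  upper-injective {i} {j} 2i+1<q 2j+1<q eq = skip-injective w D (∸-cancelˡ-≡
    (skip≤q+q (i+i<q⇒i<q i (<-trans (n<1+n _) 2i+1<q))) (skip≤q+q (i+i<q⇒i<q j (<-trans (n<1+n _) 2j+1<q))) eq)

  lower<upper : ∀ {i j} → i + i < q → suc (j + j) < q → lower i < upper j
  lower<upper {i} {j} i+i<q 2j+1<q = m+n≤o⇒m≤o∸n (suc i) (begin
    suc i + skip w D j  ≤⟨ +-monoʳ-≤ (suc i) (skip≤ w D j) ⟩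
    suc i + (j + D)     ≡⟨ +-assoc (suc i) j D ⟨
    suc (i + j) + D     ≤⟨ 1+i+j+D≤q+q i j i+i<q 2j+1<q ⟩
    q + q               ∎)
    where open ≤-Reasoning

  lower<q+q : ∀ {i} → i + i < q → lower i < q + q
  lower<q+q {i} i+i<q = ≤-trans (i+i<q⇒i<q i i+i<q) (m≤m+n q q)

  upper≤q+q : ∀ {j} → upper j ≤ q + q
  upper≤q+q {j} = m∸n≤m (q + q) (skip w D j)

  rising : ∀ {δ i} → suc (i + i) < q → EdgeLength q (w + w) δ (i + i) (upper i ∸ lower i)
  rising {δ} {i} 2i+1<q with i <? w
  ... | yes i<w rewrite skip-below {w} {D} i<w =
    long (+-mono-< i<w i<w) (q+q∸a∸b+[a+b]≡q+q i i (≤-trans (<⇒≤ (<-trans (n<1+n _) 2i+1<q)) (m≤m+n q q)))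
  ... | no i≮w rewrite skip-above {w} {D} (≮⇒≥ i≮w) =
    short (+-mono-≤ (≮⇒≥ i≮w) (≮⇒≥ i≮w)) 2i+1<q
          (short-length (trans (cong (X +_) (sym reorder)) (q+q∸a∸b+[a+b]≡q+q (i + D) i bound)))
    where
    X : ℕ
    X = q + q ∸ (i + D) ∸ i
    reorder : i + D + i ≡ i + i + D
    reorder = xy∙z≈xz∙y i D i
    bound : i + D + i ≤ q + q
    bound = subst (_≤ q + q) (sym reorder) (c+D≤q+q (<-trans (n<1+n _) 2i+1<q))

  falling : ∀ {δ i} → suc (suc (i + i)) < q → EdgeLength q (w + w) δ (suc (i + i)) (upper i ∸ lower (suc i))
  falling {δ} {i} 2i+2<q with i <? w
  ... | yes i<w rewrite skip-below {w} {D} i<w =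
    long (subst (_≤ w + w) (cong suc (+-suc i i)) (+-mono-≤ i<w i<w))
         (trans (cong (X +_) (sym (+-suc i i))) (q+q∸a∸b+[a+b]≡q+q i (suc i) bound))
    where
    X : ℕ
    X = q + q ∸ i ∸ suc i
    bound : i + suc i ≤ q + q
    bound = ≤-trans (≤-reflexive (+-suc i i)) (≤-trans (<⇒≤ (<-trans (n<1+n _) 2i+2<q)) (m≤m+n q q))
  ... | no i≮w rewrite skip-above {w} {D} (≮⇒≥ i≮w) =
    short (≤-trans (+-mono-≤ (≮⇒≥ i≮w) (≮⇒≥ i≮w)) (n≤1+n _)) 2i+2<q
          (short-length (trans (cong (X +_) (sym reorder)) (q+q∸a∸b+[a+b]≡q+q (i + D) (suc i) bound)))
    where
    X : ℕ
    X = q + q ∸ (i + D) ∸ suc i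
    reorder : i + D + suc i ≡ suc (i + i) + D
    reorder = trans (xy∙z≈xz∙y i D (suc i)) (cong (_+ D) (+-suc i i))
    bound : i + D + suc i ≤ q + q
    bound = subst (_≤ q + q) (sym reorder) (c+D≤q+q (<-trans (n<1+n _) 2i+2<q))

module LowerGap (q w D : ℕ) (fits : q + suc (w + w) + D ≡ suc (q + q)) where

  open Gap q (suc (w + w)) D fits (s≤s z≤n) public

  lower upper : ℕ → ℕ
  lower i = skip (suc w) D i
  upper i = q + q ∸ i

  lower-injective : ∀ {i j} → lower i ≡ lower j → i ≡ j
  lower-injective = skip-injective (suc w) D

  upper-injective : ∀ {i j} → suc (i + i) < q → suc (j + j) < q → upper i ≡ upper j → i ≡ j
  upper-injective {i} {j} 2i+1<q 2j+1<q = ∸-cancelˡ-≡ (i≤q+q i 2i+1<q) (i≤q+q j 2j+1<q)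
    where
    i≤q+q : ∀ i → suc (i + i) < q → i ≤ q + q
    i≤q+q i 2i+1<q = ≤-trans (<⇒≤ (i+i<q⇒i<q i (<-trans (n<1+n _) 2i+1<q))) (m≤m+n q q)

  lower<upper : ∀ {i j} → i + i < q → suc (j + j) < q → lower i < upper j
  lower<upper {i} {j} i+i<q 2j+1<q = m+n≤o⇒m≤o∸n (suc (lower i)) (begin
    suc (skip (suc w) D i) + j  ≤⟨ +-monoˡ-≤ j (s≤s (skip≤ (suc w) D i)) ⟩
    suc (i + D) + j             ≡⟨ cong suc (xy∙z≈xz∙y i D j) ⟩
    suc (i + j) + D             ≤⟨ 1+i+j+D≤q+q i j i+i<q 2j+1<q ⟩
    q + q                       ∎)
    where open ≤-Reasoning

  lower<q+q : ∀ {i} → i + i < q → lower i < q + q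
  lower<q+q {i} i+i<q = ≤-<-trans (skip≤ (suc w) D i) (+-mono-<-≤ (i+i<q⇒i<q i i+i<q) D≤q)

  upper≤q+q : ∀ {j} → upper j ≤ q + q
  upper≤q+q {j} = m∸n≤m (q + q) j

  rising : ∀ {δ i} → suc (i + i) < q → EdgeLength q (suc (w + w)) δ (i + i) (upper i ∸ lower i)
  rising {δ} {i} 2i+1<q with i ≤? w
  ... | yes i≤w rewrite skip-below {suc w} {D} (s≤s i≤w) =
    long (s≤s (+-mono-≤ i≤w i≤w)) (q+q∸a∸b+[a+b]≡q+q i i (≤-trans (<⇒≤ (<-trans (n<1+n _) 2i+1<q)) (m≤m+n q q)))
  ... | no i≰w rewrite skip-above {suc w} {D} (≰⇒> i≰w) =
    short (≤-trans (s≤s (+-monoʳ-≤ w (n≤1+n w))) (+-mono-≤ (≰⇒> i≰w) (≰⇒> i≰w))) 2i+1<q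
          (short-length (trans (cong (X +_) (+-assoc i i D)) (q+q∸a∸b+[a+b]≡q+q i (i + D) bound)))
    where
    X : ℕ
    X = q + q ∸ i ∸ (i + D)
    bound : i + (i + D) ≤ q + q
    bound = subst (_≤ q + q) (+-assoc i i D) (c+D≤q+q (<-trans (n<1+n _) 2i+1<q))

  falling : ∀ {δ i} → suc (suc (i + i)) < q → EdgeLength q (suc (w + w)) δ (suc (i + i)) (upper i ∸ lower (suc i))
  falling {δ} {i} 2i+2<q with i <? w
  ... | yes i<w rewrite skip-below {suc w} {D} (s≤s i<w) =
    long (s≤s (+-mono-< i<w i<w)) (trans (cong (X +_) (sym (+-suc i i))) (q+q∸a∸b+[a+b]≡q+q i (suc i) bound))
    where
    X : ℕ
    X = q + q ∸ i ∸ suc i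
    bound : i + suc i ≤ q + q
    bound = ≤-trans (≤-reflexive (+-suc i i)) (≤-trans (<⇒≤ (<-trans (n<1+n _) 2i+2<q)) (m≤m+n q q))
  ... | no i≮w rewrite skip-above {suc w} {D} (s≤s (≮⇒≥ i≮w)) =
    short (s≤s (+-mono-≤ (≮⇒≥ i≮w) (≮⇒≥ i≮w))) 2i+2<q
          (short-length (trans (cong (X +_) (sym reorder)) (q+q∸a∸b+[a+b]≡q+q i (suc i + D) bound)))
    where
    X : ℕ
    X = q + q ∸ i ∸ (suc i + D)
    reorder : i + (suc i + D) ≡ suc (i + i) + D
    reorder = trans (sym (+-assoc i (suc i) D)) (cong (_+ D) (+-suc i i))
    bound : i + (suc i + D) ≤ q + q
    bound = subst (_≤ q + q) (sym reorder) (c+D≤q+q (<-trans (n<1+n _) 2i+2<q))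

module EvenPath (a d δ : ℕ) (δ≤1 : δ ≤ 1) where

  m n q w D last : ℕ
  m  = suc (suc (d + d + δ)) * 2
  n  = a + a
  q  = m + n
  w  = a + (suc d + δ)
  D  = suc (suc (suc (d + d)))
  last = a + suc (d + d + δ)

  fits : q + (w + w) + D ≡ suc (q + q)
  fits = identity a d δ
    where
    identity : ∀ a d δ → let m = suc (suc (d + d + δ)) * 2 ; q = m + (a + a) ; w = a + (suc d + δ) in
               q + (w + w) + suc (suc (suc (d + d))) ≡ suc (q + q)
    identity = solve-∀

  open UpperGap q w D fits (≤-trans (s≤s z≤n) (m≤n+m (suc d + δ) a))

  closing-position : n + (m ∸ 1) ≡ suc (last + last)
  closing-position = identity a d δ
    where
    identity : ∀ a d δ → a + a + suc (suc (d + d + δ) * 2) ≡ suc (a + suc (d + d + δ) + (a + suc (d + d + δ)))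
    identity = solve-∀

  closing-code : suc (n + (m ∸ 1)) ≡ q
  closing-code = identity a d δ
    where
    identity : ∀ a d δ → suc (a + a + suc (suc (d + d + δ) * 2)) ≡ suc (suc (d + d + δ)) * 2 + (a + a)
    identity = solve-∀

  chord-length : upper last ∸ lower a ≡ q + δ
  chord-length = begin
    q + q ∸ skip w D last ∸ a        ≡⟨ cong (λ s → q + q ∸ s ∸ a) (skip-above w≤last) ⟩
    q + q ∸ (last + D) ∸ a           ≡⟨ ∸-+-assoc (q + q) (last + D) a ⟩
    q + q ∸ (last + D + a)           ≡⟨ cong (_∸ (last + D + a)) balance ⟨
    q + δ + (last + D + a) ∸ (last + D + a) ≡⟨ m+n∸n≡m (q + δ) (last + D + a) ⟩
    q + δ                          ∎
    where
    open ≡-Reasoning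
    w≤last : w ≤ last
    w≤last = +-monoʳ-≤ a (s≤s (+-monoˡ-≤ δ (m≤n+m d d)))
    balance : q + δ + (last + D + a) ≡ q + q
    balance = identity a d δ
      where
      identity : ∀ a d δ → let q = suc (suc (d + d + δ)) * 2 + (a + a) in
                 q + δ + (a + suc (d + d + δ) + suc (suc (suc (d + d))) + a) ≡ q + q
      identity = solve-∀

  zigzag : Zigzag m n
  zigzag = record
    { L                = w + w
    ; δ                = δ
    ; L<q              = 2≤D⇒L<q (s≤s (s≤s z≤n))
    ; δ≤1              = δ≤1
    ; lower            = lower
    ; upper            = upper
    ; lower-injective  = λ _ _ → id
    ; upper-injective  = upper-injective
    ; lower<upper      = lower<upper
    ; lower<q+q        = lower<q+q
    ; upper≤q+q        = λ {j} _ → upper≤q+q {j}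
    ; rising           = λ {i} → rising {δ} {i}
    ; falling          = λ {i} → falling {δ} {i}
    ; closing-crossing = descending (trans (cong isOdd closing-position) (isOdd-odd last)) (isOdd-even a)
                                    (subst₂ _<_ (sym label-n) (sym label-chord) a<last)
    ; closing-length   = chord closing-code (begin
        ∣ label (n + (m ∸ 1)) - label n ∣  ≡⟨ cong₂ ∣_-_∣ label-chord label-n ⟩
        ∣ upper last - lower a ∣           ≡⟨ m≤n⇒∣n-m∣≡n∸m (<⇒≤ a<last) ⟩
        upper last ∸ lower a               ≡⟨ chord-length ⟩
        q + δ                              ∎)
    }
    where
    open ≡-Reasoning
    label : ℕ → ℕ
    label = interleave lower upper
    label-chord : label (n + (m ∸ 1)) ≡ upper last
    label-chord = trans (cong label closing-position) (interleave-odd lower upper last)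
    label-n : label n ≡ lower a
    label-n = interleave-even lower upper a
    a<last : lower a < upper last
    a<last = lower<upper (m<n+m n {m} z<s) (subst (_< q) closing-position (≤-reflexive closing-code))

module OddPath (a d δ : ℕ) (δ≤1 : δ ≤ 1) where

  m n q w D last : ℕ
  m  = suc (suc (d + d + δ)) * 2
  n  = suc (a + a)
  q  = m + n
  w  = a + (suc d + δ)
  D  = suc (suc (suc (d + d)))
  last = a + suc (suc (d + d + δ))

  fits : q + suc (w + w) + D ≡ suc (q + q)
  fits = identity a d δ
    where
    identity : ∀ a d δ → let m = suc (suc (d + d + δ)) * 2 ; q = m + suc (a + a) ; w = a + (suc d + δ) in
               q + suc (w + w) + suc (suc (suc (d + d))) ≡ suc (q + q)
    identity = solve-∀

  open LowerGap q w D fits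

  closing-position : n + (m ∸ 1) ≡ last + last
  closing-position = identity a d δ
    where
    identity : ∀ a d δ → suc (a + a) + suc (suc (d + d + δ) * 2) ≡
                         a + suc (suc (d + d + δ)) + (a + suc (suc (d + d + δ)))
    identity = solve-∀

  closing-code : suc (n + (m ∸ 1)) ≡ q
  closing-code = identity a d δ
    where
    identity : ∀ a d δ → suc (suc (a + a) + suc (suc (d + d + δ) * 2)) ≡ suc (suc (d + d + δ)) * 2 + suc (a + a)
    identity = solve-∀

  chord-length : upper a ∸ lower last ≡ q + δ
  chord-length = begin
    q + q ∸ a ∸ skip (suc w) D last   ≡⟨ cong (q + q ∸ a ∸_) (skip-above w<last) ⟩
    q + q ∸ a ∸ (last + D)            ≡⟨ ∸-+-assoc (q + q) a (last + D) ⟩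
    q + q ∸ (a + (last + D))          ≡⟨ cong (_∸ (a + (last + D))) balance ⟨
    q + δ + (a + (last + D)) ∸ (a + (last + D)) ≡⟨ m+n∸n≡m (q + δ) (a + (last + D)) ⟩
    q + δ                           ∎
    where
    open ≡-Reasoning
    w<last : suc w ≤ last
    w<last = subst (_≤ last) (+-suc a (suc d + δ)) (+-monoʳ-≤ a (s≤s (s≤s (+-monoˡ-≤ δ (m≤n+m d d)))))
    balance : q + δ + (a + (last + D)) ≡ q + q
    balance = identity a d δ
      where
      identity : ∀ a d δ → let q = suc (suc (d + d + δ)) * 2 + suc (a + a) in
                 q + δ + (a + (a + suc (suc (d + d + δ)) + suc (suc (suc (d + d))))) ≡ q + q
      identity = solve-∀

  zigzag : Zigzag m n
  zigzag = record
    { L                = suc (w + w)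
    ; δ                = δ
    ; L<q              = 2≤D⇒L<q (s≤s (s≤s z≤n))
    ; δ≤1              = δ≤1
    ; lower            = lower
    ; upper            = upper
    ; lower-injective  = λ {i} {j} _ _ → lower-injective {i} {j}
    ; upper-injective  = λ {i} {j} → upper-injective {i} {j}
    ; lower<upper      = λ {i} {j} → lower<upper {i} {j}
    ; lower<q+q        = λ {i} → lower<q+q {i}
    ; upper≤q+q        = λ {j} _ → upper≤q+q {j}
    ; rising           = λ {i} → rising {δ} {i}
    ; falling          = λ {i} → falling {δ} {i}
    ; closing-crossing = ascending (trans (cong isOdd closing-position) (isOdd-even last)) (isOdd-odd a)
                                   (subst₂ _<_ (sym label-chord) (sym label-n) last<a)
    ; closing-length   = chord closing-code (begin
        ∣ label (n + (m ∸ 1)) - label n ∣  ≡⟨ cong₂ ∣_-_∣ label-chord label-n ⟩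
        ∣ lower last - upper a ∣           ≡⟨ m≤n⇒∣m-n∣≡n∸m (<⇒≤ last<a) ⟩
        upper a ∸ lower last               ≡⟨ chord-length ⟩
        q + δ                              ∎)
    }
    where
    open ≡-Reasoning
    label : ℕ → ℕ
    label = interleave lower upper
    label-chord : label (n + (m ∸ 1)) ≡ lower last
    label-chord = trans (cong label closing-position) (interleave-even lower upper last)
    label-n : label n ≡ upper a
    label-n = interleave-odd lower upper a
    last<a : lower last < upper a
    last<a = lower<upper {last} {a} (subst (_< q) closing-position (≤-reflexive closing-code)) (m<n+m n {m} z<s)

decomposition : ∀ {m n} .{{_ : NonZero m}} → Zigzag m n → ∀ t → CyclicDecomposition m n (t * (2 * (m + n)))
decomposition Z = RhoPlusDecomposition.decomposition (FromZigzag.rhoPlus Z)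

zigzag : ∀ d δ → δ ≤ 1 → ∀ n → Zigzag (suc (suc (d + d + δ)) * 2) n
zigzag d δ δ≤1 n with half n
... | even a = EvenPath.zigzag a d δ δ≤1
... | odd a  = OddPath.zigzag a d δ δ≤1

corollary6 : ∀ (m n : ℕ) → 4 ≤ m → 2 ∣ m →
    ∀ (t : ℕ) → CyclicDecomposition m n (t * (2 * (m + n)))
corollary6 m n 4≤m (divides (suc (suc k)) refl) t with half k
... | even d = subst (λ k → CyclicDecomposition (suc (suc k) * 2) n (t * (2 * (suc (suc k) * 2 + n))))
                     (+-identityʳ (d + d)) (decomposition (zigzag d 0 z≤n n) t)
... | odd d  = subst (λ k → CyclicDecomposition (suc (suc k) * 2) n (t * (2 * (suc (suc k) * 2 + n))))
                     (+-comm (d + d) 1) (decomposition (zigzag d 1 (s≤s z≤n) n) t)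
corollary6 .(0 * 2) n () (divides 0 refl) t
corollary6 .(1 * 2) n (s≤s (s≤s ())) (divides 1 refl) t
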